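{- Let $d=3k$ for a positive integer $k$, and let $\varphi$ be a partial proper $d$-edge coloring of $Q_d$ such that every colored edge is at distance $1$ from at most one other edge with the same color. Then $\varphi$ is avoidable.
   Context: $Q_d$ is the $d$-dimensional hypercube. The distance between two edges $e,e'$ is the number of edges in a shortest path between an endpoint of $e$ and an endpoint of $e'$. A partial proper $d$-edge coloring assigns colors from $\{1,\dots,d\}$ to some edges so that adjacent colored edges receive different colors; it is avoidable if there is a proper $d$-edge coloring $f$ of $Q_d$ with colors $1,\dots,d$ such that $f(e)\neq\varphi(e)$ for every colored edge $e$. -}

module Defs where

open import Data.Nat using (ℕ)
open import Data.Fin using (Fin)
open import Data.Bool using (Bool; false; not)
open import Data.Vec using (Vec; lookup; updateAt)
open import Data.Maybe using (Maybe; just)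
open import Data.Product using (Σ; Σ-syntax; ∃-syntax; _×_; _,_)
open import Data.Sum using (_⊎_)
open import Relation.Binary.PropositionalEquality using (_≡_; _≢_)
open import Relation.Nullary using (¬_)
open import Data.Empty using (⊥)

Vertex : ℕ → Set
Vertex d = Vec Bool d

flip : ∀ {d} → Vertex d → Fin d → Vertex d
flip v i = updateAt v i not

Adjacent : ∀ {d} → Vertex d → Vertex d → Set
Adjacent {d} u w = ∃[ i ] w ≡ flip u i

-- An edge of Q_d: a direction i and its lower endpoint v (with v_i = 0);
-- the other endpoint is flip v i. Each edge has exactly one such representation.
Edge : ℕ → Set
Edge d = Σ[ i ∈ Fin d ] Σ[ v ∈ Vertex d ] lookup v i ≡ false

dir : ∀ {d} → Edge d → Fin d
dir (i , _ , _) = i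

IsEndpoint : ∀ {d} → Vertex d → Edge d → Set
IsEndpoint x (i , v , _) = (x ≡ v) ⊎ (x ≡ flip v i)

ShareEndpoint : ∀ {d} → Edge d → Edge d → Set
ShareEndpoint {d} e e' = ∃[ x ] (IsEndpoint {d} x e × IsEndpoint x e')

AdjEdges : ∀ {d} → Edge d → Edge d → Set
AdjEdges e e' = e ≢ e' × ShareEndpoint e e'

-- Distance exactly 1 between edges: the shortest path between an endpoint
-- of e and an endpoint of e' has exactly one edge, i.e. no endpoint is shared
-- but some endpoint of e is adjacent to some endpoint of e'.
Dist1 : ∀ {d} → Edge d → Edge d → Set
Dist1 {d} e e' = ¬ ShareEndpoint e e'
  × ∃[ x ] ∃[ y ] (IsEndpoint {d} x e × IsEndpoint y e' × Adjacent x y)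

PartialColoring : ℕ → Set
PartialColoring d = Edge d → Maybe (Fin d)

IsProperPartial : ∀ {d} → PartialColoring d → Set
IsProperPartial {d} φ = ∀ (e e' : Edge d) (c : Fin d) →
  AdjEdges e e' → φ e ≡ just c → φ e' ≡ just c → ⊥

IsProperColoring : ∀ {d} → (Edge d → Fin d) → Set
IsProperColoring {d} f = ∀ (e e' : Edge d) → AdjEdges e e' → f e ≢ f e'

Avoidable : ∀ {d} → PartialColoring d → Set
Avoidable {d} φ = Σ[ f ∈ (Edge d → Fin d) ]
  (IsProperColoring f × (∀ (e : Edge d) (c : Fin d) → φ e ≡ just c → f e ≢ c))

AtMostOneSameColorAtDist1 : ∀ {d} → PartialColoring d → Set
AtMostOneSameColorAtDist1 {d} φ = ∀ (e e₁ e₂ : Edge d) (c : Fin d) →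
  φ e ≡ just c → φ e₁ ≡ just c → φ e₂ ≡ just c →
  Dist1 e e₁ → Dist1 e e₂ → e₁ ≡ e₂

-- Split the d = m·k directions of Q_d into k blocks of m directions (direction r·k + j lies in
-- block j). Every edge of Q_d lies in exactly one copy of Q_m spanned by its block, and reserving
-- the colours of block j for the copies spanned by block j reduces the problem to the copies:
-- adjacent edges of equal colour lie in one copy, and distance 1 inside a copy is distance 1 in
-- Q_d, so the restriction of φ to a copy again satisfies the hypotheses. For m = 3 the statement
-- is a finite check on Q_3: a case-split certificate shows that on each branch either one of the
-- 24 proper 3-edge-colourings of Q_3 avoids φ or the hypotheses are violated.

module Submission where

open import Defs
open import Data.Nat using (ℕ; _*_; _≤_)

open import Level using (0ℓ)
open import Function using (_∘_; case_of_)
open import Data.Bool using (Bool; true; false; not; T; _∧_; if_then_else_)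
import Data.Bool.Properties as Bool
open import Data.Fin using (Fin; toℕ; #_; combine; remQuot)
open import Data.Nat.DivMod using (_mod_)
open import Data.Fin.Patterns using (0F; 1F; 2F)
open import Data.Fin.Properties
  using (any?; all?; combine-remQuot; remQuot-combine; combine-injectiveˡ; combine-injective)
  renaming (_≟_ to _≟ᶠ_)
import Data.Nat as ℕ
open import Data.Vec using (Vec; []; _∷_; lookup; tabulate; replicate)
import Data.Vec.Properties as Vec
open import Data.Vec.Relation.Binary.Pointwise.Extensional using (ext; Pointwise-≡⇒≡)
open import Data.List using (List; []; _∷_)
open import Data.List.Relation.Unary.All as All using (All; []; _∷_)
open import Data.List.Relation.Unary.Any as Any using (Any)
open import Data.List.Membership.Propositional using (_∈_)
open import Data.Maybe using (Maybe; just; nothing; _>>=_)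
import Data.Maybe.Properties as Maybe
open import Data.Product using (_×_; _,_; proj₁; proj₂; ∃-syntax; uncurry)
import Data.Product.Properties as Product
open import Data.Sum using (_⊎_; inj₁; inj₂)
open import Data.Empty using (⊥-elim)
open import Function.Bundles using (Equivalence)
open import Relation.Unary using (Pred; Decidable)
open import Relation.Binary using (DecidableEquality)
open import Relation.Nullary using (¬_; Dec; does; yes; no; ¬?)
open import Relation.Nullary.Decidable
  using (⌊_⌋; map′; toWitness; dec-true; dec-false; _×-dec_; _⊎-dec_; _→-dec_)
open import Relation.Binary.PropositionalEquality
  using (_≡_; _≢_; refl; sym; trans; cong; subst₂; module ≡-Reasoning)
open ≡-Reasoning
open import Axiom.UniquenessOfIdentityProofs using (module Decidable⇒UIP)

AllAvoidable : ℕ → Set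
AllAvoidable d =
  (φ : PartialColoring d) → IsProperPartial φ → AtMostOneSameColorAtDist1 φ → Avoidable φ

_≟ᵛ_ : ∀ {d} → DecidableEquality (Vertex d)
_≟ᵛ_ = Vec.≡-dec Bool._≟_

lookup-flip : ∀ {d} (v : Vertex d) i → lookup (flip v i) i ≡ not (lookup v i)
lookup-flip v i = Vec.lookup∘updateAt i v

lookup-flip-≢ : ∀ {d} (v : Vertex d) {i j} → j ≢ i → lookup (flip v i) j ≡ lookup v j
lookup-flip-≢ v {i} {j} j≢i = Vec.lookup∘updateAt′ j i j≢i v

lookup-≡ : ∀ {d} {u v : Vertex d} → (∀ i → lookup u i ≡ lookup v i) → u ≡ v
lookup-≡ = Pointwise-≡⇒≡ ∘ ext

edge-≡ : ∀ {d} {i i′ : Fin d} {v v′ : Vertex d}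
         {p : lookup v i ≡ false} {p′ : lookup v′ i′ ≡ false} →
         i ≡ i′ → v ≡ v′ → _≡_ {A = Edge d} (i , v , p) (i′ , v′ , p′)
edge-≡ {i = i} {v = v} {p = p} {p′ = p′} refl refl =
  cong (λ q → i , v , q) (Decidable⇒UIP.≡-irrelevant Bool._≟_ p p′)

-- Q_(m·k) as a union of copies of Q_m

module Blowup (m k : ℕ) where

  block : Fin (m * k) → Fin k
  block i = proj₂ (remQuot {m} k i)

  offset : Fin (m * k) → Fin m
  offset i = proj₁ (remQuot {m} k i)

  combine-offset-block : ∀ i → combine (offset i) (block i) ≡ i
  combine-offset-block = combine-remQuot {m} k

  offset-combine : ∀ r j → offset (combine r j) ≡ r
  offset-combine r j = cong proj₁ (remQuot-combine {m} {k} r j)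

  block-combine : ∀ r j → block (combine r j) ≡ j
  block-combine r j = cong proj₂ (remQuot-combine {m} {k} r j)

  combine-≢ : ∀ {r : Fin m} {j} i → block i ≢ j → i ≢ combine r j
  combine-≢ {r} {j} i i∉j refl = i∉j (block-combine r j)

  splice : Vertex (m * k) → Fin k → Vertex m → Vertex (m * k)
  splice v j w = tabulate λ i → if does (block i ≟ᶠ j) then lookup w (offset i) else lookup v i

  slice : Vertex (m * k) → Fin k → Vertex m
  slice v j = tabulate λ r → lookup v (combine r j)

  lookup-splice-∈ : ∀ v j w i → block i ≡ j → lookup (splice v j w) i ≡ lookup w (offset i)
  lookup-splice-∈ v j w i i∈j = trans (Vec.lookup∘tabulate _ i)
    (cong (λ b → if b then lookup w (offset i) else lookup v i) (dec-true (block i ≟ᶠ j) i∈j))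

  lookup-splice-∉ : ∀ v j w i → block i ≢ j → lookup (splice v j w) i ≡ lookup v i
  lookup-splice-∉ v j w i i∉j = trans (Vec.lookup∘tabulate _ i)
    (cong (λ b → if b then lookup w (offset i) else lookup v i) (dec-false (block i ≟ᶠ j) i∉j))

  lookup-splice-combine : ∀ v j w r → lookup (splice v j w) (combine r j) ≡ lookup w r
  lookup-splice-combine v j w r =
    trans (lookup-splice-∈ v j w _ (block-combine r j)) (cong (lookup w) (offset-combine r j))

  lookup-slice : ∀ v j r → lookup (slice v j) r ≡ lookup v (combine r j)
  lookup-slice v j = Vec.lookup∘tabulate (λ r → lookup v (combine r j))

  slice-splice : ∀ v j w → slice (splice v j w) j ≡ w
  slice-splice v j w =
    lookup-≡ λ r → trans (lookup-slice (splice v j w) j r) (lookup-splice-combine v j w r)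

  splice-slice : ∀ v j → splice v j (slice v j) ≡ v
  splice-slice v j = lookup-≡ λ i → case block i ≟ᶠ j of λ where
    (yes i∈j) → trans (lookup-splice-∈ v j (slice v j) i i∈j) (trans (lookup-slice v j (offset i))
                  (cong (lookup v) (trans (cong (combine (offset i)) (sym i∈j)) (combine-offset-block i))))
    (no i∉j)  → lookup-splice-∉ v j (slice v j) i i∉j

  splice-splice : ∀ v j w w′ → splice (splice v j w′) j w ≡ splice v j w
  splice-splice v j w w′ = lookup-≡ λ i → case block i ≟ᶠ j of λ where
    (yes i∈j) → trans (lookup-splice-∈ (splice v j w′) j w i i∈j)
                  (sym (lookup-splice-∈ v j w i i∈j))
    (no i∉j)  → trans (lookup-splice-∉ (splice v j w′) j w i i∉j)
                  (trans (lookup-splice-∉ v j w′ i i∉j) (sym (lookup-splice-∉ v j w i i∉j)))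

  lookup-splice-flip : ∀ v j w r i →
                       lookup (splice v j (flip w r)) i ≡ lookup (flip (splice v j w) (combine r j)) i
  lookup-splice-flip v j w r i with i ≟ᶠ combine r j | block i ≟ᶠ j
  ... | yes refl | _ = begin
    lookup (splice v j (flip w r)) (combine r j)             ≡⟨ lookup-splice-combine v j (flip w r) r ⟩
    lookup (flip w r) r                                      ≡⟨ lookup-flip w r ⟩
    not (lookup w r)                                         ≡⟨ cong not (lookup-splice-combine v j w r) ⟨
    not (lookup (splice v j w) (combine r j))                ≡⟨ lookup-flip (splice v j w) (combine r j) ⟨
    lookup (flip (splice v j w) (combine r j)) (combine r j) ∎
  ... | no i≢rj | yes i∈j = begin
    lookup (splice v j (flip w r)) i           ≡⟨ lookup-splice-∈ v j (flip w r) i i∈j ⟩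
    lookup (flip w r) (offset i)               ≡⟨ lookup-flip-≢ w offset≢r ⟩
    lookup w (offset i)                        ≡⟨ lookup-splice-∈ v j w i i∈j ⟨
    lookup (splice v j w) i                    ≡⟨ lookup-flip-≢ (splice v j w) i≢rj ⟨
    lookup (flip (splice v j w) (combine r j)) i ∎
    where
    offset≢r : offset i ≢ r
    offset≢r refl = i≢rj (trans (sym (combine-offset-block i)) (cong (combine (offset i)) i∈j))
  ... | no i≢rj | no i∉j = begin
    lookup (splice v j (flip w r)) i           ≡⟨ lookup-splice-∉ v j (flip w r) i i∉j ⟩
    lookup v i                                 ≡⟨ lookup-splice-∉ v j w i i∉j ⟨
    lookup (splice v j w) i                    ≡⟨ lookup-flip-≢ (splice v j w) i≢rj ⟨
    lookup (flip (splice v j w) (combine r j)) i ∎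

  splice-flip : ∀ v j w r → splice v j (flip w r) ≡ flip (splice v j w) (combine r j)
  splice-flip v j w r = lookup-≡ (lookup-splice-flip v j w r)

  splice-flip-overwritten : ∀ v j w (r : Fin m) → splice (flip v (combine r j)) j w ≡ splice v j w
  splice-flip-overwritten v j w r = lookup-≡ λ i → case block i ≟ᶠ j of λ where
    (yes i∈j) → trans (lookup-splice-∈ (flip v (combine r j)) j w i i∈j)
                  (sym (lookup-splice-∈ v j w i i∈j))
    (no i∉j)  → trans (lookup-splice-∉ (flip v (combine r j)) j w i i∉j)
                  (trans (lookup-flip-≢ v (combine-≢ i i∉j)) (sym (lookup-splice-∉ v j w i i∉j)))

  slice-flip : ∀ v j r → slice (flip v (combine r j)) j ≡ flip (slice v j) r
  slice-flip v j r = lookup-≡ λ r′ → case r′ ≟ᶠ r of λ where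
    (yes refl) → trans (lookup-slice (flip v (combine r j)) j r) (trans (lookup-flip v (combine r j))
                   (sym (trans (lookup-flip (slice v j) r) (cong not (lookup-slice v j r)))))
    (no r′≢r)  → trans (lookup-slice (flip v (combine r j)) j r′)
                   (trans (lookup-flip-≢ v (r′≢r ∘ combine-injectiveˡ r′ j r j))
                     (sym (trans (lookup-flip-≢ (slice v j) r′≢r) (lookup-slice v j r′))))

  -- The copy of Q_m spanned by the directions of block j through the vertex B.
  Copy : Set
  Copy = Fin k × Vertex (m * k)

  liftEdge : Copy → Edge m → Edge (m * k)
  liftEdge (j , B) (r , w , w[r]≡0) =
    combine r j , splice B j w , trans (lookup-splice-combine B j w r) w[r]≡0

  liftEdge-injective : ∀ C {e e′} → liftEdge C e ≡ liftEdge C e′ → e ≡ e′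
  liftEdge-injective (j , B) {r , w , _} {r′ , w′ , _} eq = edge-≡
    (combine-injectiveˡ r j r′ j (cong dir eq))
    (trans (sym (slice-splice B j w))
      (trans (cong (λ e → slice (proj₁ (proj₂ e)) j) eq) (slice-splice B j w′)))

  splice-endpoint : ∀ C e {x} → IsEndpoint x e →
                    IsEndpoint (splice (proj₂ C) (proj₁ C) x) (liftEdge C e)
  splice-endpoint (j , B) (r , w , _) (inj₁ refl) = inj₁ refl
  splice-endpoint (j , B) (r , w , _) (inj₂ refl) = inj₂ (splice-flip B j w r)

  slice-endpoint : ∀ C e {x} → IsEndpoint x (liftEdge C e) → IsEndpoint (slice x (proj₁ C)) e
  slice-endpoint (j , B) (r , w , _) (inj₁ refl) = inj₁ (slice-splice B j w)
  slice-endpoint (j , B) (r , w , _) (inj₂ refl) =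
    inj₂ (trans (slice-flip (splice B j w) j r) (cong (λ u → flip u r) (slice-splice B j w)))

  liftEdge-preserves-adjEdges : ∀ C {e e′} → AdjEdges e e′ → AdjEdges (liftEdge C e) (liftEdge C e′)
  liftEdge-preserves-adjEdges C {e} {e′} (e≢e′ , x , ex , ex′) =
    e≢e′ ∘ liftEdge-injective C , _ , splice-endpoint C e ex , splice-endpoint C e′ ex′

  liftEdge-reflects-adjEdges : ∀ C {e e′} → AdjEdges (liftEdge C e) (liftEdge C e′) → AdjEdges e e′
  liftEdge-reflects-adjEdges C {e} {e′} (ce≢ce′ , x , ex , ex′) =
    ce≢ce′ ∘ cong (liftEdge C) , _ , slice-endpoint C e ex , slice-endpoint C e′ ex′

  liftEdge-preserves-dist1 : ∀ C {e e′} → Dist1 e e′ → Dist1 (liftEdge C e) (liftEdge C e′)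
  liftEdge-preserves-dist1 C@(j , B) {e} {e′} (¬share , x , y , ex , ey , r , y≡x+r) =
    (λ (z , ez , ez′) → ¬share (_ , slice-endpoint C e ez , slice-endpoint C e′ ez′)) ,
    _ , _ , splice-endpoint C e ex , splice-endpoint C e′ ey ,
    combine r j , trans (cong (splice B j) y≡x+r) (splice-flip B j x r)

  anchor : Fin k → Vertex (m * k) → Vertex (m * k)
  anchor j v = splice v j (replicate m false)

  copyOf : Edge (m * k) → Copy
  copyOf (i , v , _) = block i , anchor (block i) v

  sliceEdge : Edge (m * k) → Edge m
  sliceEdge (i , v , v[i]≡0) = offset i , slice v (block i) ,
    trans (lookup-slice v (block i) (offset i)) (trans (cong (lookup v) (combine-offset-block i)) v[i]≡0)

  liftEdge-sliceEdge : ∀ e → liftEdge (copyOf e) (sliceEdge e) ≡ e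
  liftEdge-sliceEdge (i , v , _) = edge-≡ (combine-offset-block i)
    (trans (splice-splice v (block i) (slice v (block i)) (replicate m false)) (splice-slice v (block i)))

  anchor-endpoint : ∀ {x} e → IsEndpoint x e → (block (dir e) , anchor (block (dir e)) x) ≡ copyOf e
  anchor-endpoint (i , v , _) (inj₁ refl) = refl
  anchor-endpoint (i , v , _) (inj₂ refl) = cong (block i ,_) (begin
    anchor (block i) (flip v i)
      ≡⟨ cong (anchor (block i) ∘ flip v) (combine-offset-block i) ⟨
    anchor (block i) (flip v (combine (offset i) (block i)))
      ≡⟨ splice-flip-overwritten v (block i) (replicate m false) (offset i) ⟩
    anchor (block i) v ∎)

  shareEndpoint⇒sameCopy : ∀ {e e′} → ShareEndpoint e e′ → block (dir e) ≡ block (dir e′) →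
                           copyOf e ≡ copyOf e′
  shareEndpoint⇒sameCopy {e} {e′} (x , ex , ex′) same-block = begin
    copyOf e                                   ≡⟨ anchor-endpoint e ex ⟨
    block (dir e) , anchor (block (dir e)) x   ≡⟨ cong (λ j → j , anchor j x) same-block ⟩
    block (dir e′) , anchor (block (dir e′)) x ≡⟨ anchor-endpoint e′ ex′ ⟩
    copyOf e′                                  ∎

  blockColour : Fin k → Fin (m * k) → Maybe (Fin m)
  blockColour j c = if does (block c ≟ᶠ j) then just (offset c) else nothing

  blockColour-just : ∀ j c {a} → blockColour j c ≡ just a → c ≡ combine a j
  blockColour-just j c eq with block c ≟ᶠ j
  ... | yes refl =
    trans (sym (combine-offset-block c)) (cong (λ a → combine a (block c)) (Maybe.just-injective eq))

  blockColour-combine : ∀ a j → blockColour j (combine a j) ≡ just a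
  blockColour-combine a j rewrite dec-true (block (combine a j) ≟ᶠ j) (block-combine a j) =
    cong just (offset-combine a j)

  restrict : PartialColoring (m * k) → Copy → PartialColoring m
  restrict φ C e = φ (liftEdge C e) >>= blockColour (proj₁ C)

  restrict-just : ∀ φ C e {a} → restrict φ C e ≡ just a →
                  φ (liftEdge C e) ≡ just (combine a (proj₁ C))
  restrict-just φ C e eq with φ (liftEdge C e)
  ... | just c = cong just (blockColour-just (proj₁ C) c eq)

  restrict-preserves-proper : ∀ {φ} C → IsProperPartial φ → IsProperPartial (restrict φ C)
  restrict-preserves-proper {φ} C proper e e′ a adj φe φe′ =
    proper (liftEdge C e) (liftEdge C e′) _ (liftEdge-preserves-adjEdges C adj)
      (restrict-just φ C e φe) (restrict-just φ C e′ φe′)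

  restrict-preserves-tame : ∀ {φ} C → AtMostOneSameColorAtDist1 φ →
                            AtMostOneSameColorAtDist1 (restrict φ C)
  restrict-preserves-tame {φ} C tame e e₁ e₂ a φe φe₁ φe₂ d₁ d₂ = liftEdge-injective C
    (tame (liftEdge C e) (liftEdge C e₁) (liftEdge C e₂) _
      (restrict-just φ C e φe) (restrict-just φ C e₁ φe₁) (restrict-just φ C e₂ φe₂)
      (liftEdge-preserves-dist1 C {e} {e₁} d₁) (liftEdge-preserves-dist1 C {e} {e₂} d₂))

  allAvoidable-* : AllAvoidable m → AllAvoidable (m * k)
  allAvoidable-* avoidable φ proper tame = f , f-proper , f-avoids
    where
    local : ∀ C → Avoidable (restrict φ C)
    local C = avoidable (restrict φ C) (restrict-preserves-proper C proper) (restrict-preserves-tame C tame)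

    localColour : Copy → Edge m → Fin m
    localColour C = proj₁ (local C)

    f : Edge (m * k) → Fin (m * k)
    f e = combine (localColour (copyOf e) (sliceEdge e)) (block (dir e))

    f-avoids : ∀ e c → φ e ≡ just c → f e ≢ c
    f-avoids e c φe≡c refl = proj₂ (proj₂ (local (copyOf e))) (sliceEdge e) _ restricted refl
      where
      j = block (dir e)
      restricted : restrict φ (copyOf e) (sliceEdge e) ≡ just (localColour (copyOf e) (sliceEdge e))
      restricted = begin
        (φ (liftEdge (copyOf e) (sliceEdge e)) >>= blockColour j)
          ≡⟨ cong (λ e → φ e >>= blockColour j) (liftEdge-sliceEdge e) ⟩
        (φ e >>= blockColour j)                       ≡⟨ cong (_>>= blockColour j) φe≡c ⟩
        blockColour j (f e)                           ≡⟨ blockColour-combine _ j ⟩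
        just (localColour (copyOf e) (sliceEdge e))   ∎

    f-proper : IsProperColoring f
    f-proper e e′ adj@(_ , share) fe≡fe′ =
      proj₁ (proj₂ (local C)) s s′ adj′
        (trans same-colour (cong (λ C → localColour C s′) (sym same-copy)))
      where
      C = copyOf e
      s = sliceEdge e
      s′ = sliceEdge e′
      same-colour-and-block :
        localColour C s ≡ localColour (copyOf e′) s′ × block (dir e) ≡ block (dir e′)
      same-colour-and-block = combine-injective _ _ _ _ fe≡fe′
      same-colour : localColour C s ≡ localColour (copyOf e′) s′
      same-colour = proj₁ same-colour-and-block
      same-copy : C ≡ copyOf e′
      same-copy = shareEndpoint⇒sameCopy {e} {e′} share (proj₂ same-colour-and-block)
      e′≡ : liftEdge C s′ ≡ e′
      e′≡ = trans (cong (λ C → liftEdge C s′) same-copy) (liftEdge-sliceEdge e′)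
      adj′ : AdjEdges s s′
      adj′ = liftEdge-reflects-adjEdges C (subst₂ AdjEdges (sym (liftEdge-sliceEdge e)) (sym e′≡) adj)

-- The case Q_3

_≟ᴱ_ : ∀ {d} → DecidableEquality (Edge d)
(i , v , _) ≟ᴱ (i′ , v′ , _) with i ≟ᶠ i′ | v ≟ᵛ v′
... | yes refl | yes refl = yes (edge-≡ refl refl)
... | no i≢i′  | _        = no (i≢i′ ∘ cong dir)
... | yes _    | no v≢v′  = no (v≢v′ ∘ cong (proj₁ ∘ proj₂))

isEndpoint? : ∀ {d} (x : Vertex d) e → Dec (IsEndpoint x e)
isEndpoint? x (i , v , _) = x ≟ᵛ v ⊎-dec x ≟ᵛ flip v i

someEndpoint? : ∀ {d} {P : Pred (Vertex d) 0ℓ} → Decidable P →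
                ∀ e → Dec (∃[ x ] (IsEndpoint x e × P x))
someEndpoint? P? (i , v , _) with P? v | P? (flip v i)
... | yes Pv | _      = yes (v , inj₁ refl , Pv)
... | no _   | yes Pw = yes (flip v i , inj₂ refl , Pw)
... | no ¬Pv | no ¬Pw = no λ where
  (_ , inj₁ refl , Pv) → ¬Pv Pv
  (_ , inj₂ refl , Pw) → ¬Pw Pw

shareEndpoint? : ∀ {d} (e e′ : Edge d) → Dec (ShareEndpoint e e′)
shareEndpoint? e e′ = someEndpoint? (λ x → isEndpoint? x e′) e

adjEdges? : ∀ {d} (e e′ : Edge d) → Dec (AdjEdges e e′)
adjEdges? e e′ = ¬? (e ≟ᴱ e′) ×-dec shareEndpoint? e e′

adjacent? : ∀ {d} (x y : Vertex d) → Dec (Adjacent x y)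
adjacent? x y = any? λ i → y ≟ᵛ flip x i

dist1? : ∀ {d} (e e′ : Edge d) → Dec (Dist1 e e′)
dist1? e e′ = ¬? (shareEndpoint? e e′) ×-dec map′
  (λ (x , ex , y , ey , xy) → x , y , ex , ey , xy)
  (λ (x , y , ex , ey , xy) → x , ex , y , ey , xy)
  (someEndpoint? (λ x → someEndpoint? (adjacent? x) e′) e)

-- Edge 4i + t has direction i; the other two coordinates of its lower endpoint are the binary
-- digits of t, least significant first.
edges : Vec (Edge 3) 12
edges =
  (0F , false ∷ false ∷ false ∷ [] , refl) ∷ (0F , false ∷ true ∷ false ∷ [] , refl) ∷
  (0F , false ∷ false ∷ true ∷ [] , refl) ∷ (0F , false ∷ true ∷ true ∷ [] , refl) ∷
  (1F , false ∷ false ∷ false ∷ [] , refl) ∷ (1F , true ∷ false ∷ false ∷ [] , refl) ∷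
  (1F , false ∷ false ∷ true ∷ [] , refl) ∷ (1F , true ∷ false ∷ true ∷ [] , refl) ∷
  (2F , false ∷ false ∷ false ∷ [] , refl) ∷ (2F , true ∷ false ∷ false ∷ [] , refl) ∷
  (2F , false ∷ true ∷ false ∷ [] , refl) ∷ (2F , true ∷ true ∷ false ∷ [] , refl) ∷ []

edge : Fin 12 → Edge 3
edge = lookup edges

edge-surjective : ∀ e → ∃[ a ] edge a ≡ e
edge-surjective (0F , false ∷ false ∷ false ∷ [] , refl) = # 0 , refl
edge-surjective (0F , false ∷ true ∷ false ∷ [] , refl) = # 1 , refl
edge-surjective (0F , false ∷ false ∷ true ∷ [] , refl) = # 2 , refl
edge-surjective (0F , false ∷ true ∷ true ∷ [] , refl) = # 3 , refl
edge-surjective (1F , false ∷ false ∷ false ∷ [] , refl) = # 4 , refl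
edge-surjective (1F , true ∷ false ∷ false ∷ [] , refl) = # 5 , refl
edge-surjective (1F , false ∷ false ∷ true ∷ [] , refl) = # 6 , refl
edge-surjective (1F , true ∷ false ∷ true ∷ [] , refl) = # 7 , refl
edge-surjective (2F , false ∷ false ∷ false ∷ [] , refl) = # 8 , refl
edge-surjective (2F , true ∷ false ∷ false ∷ [] , refl) = # 9 , refl
edge-surjective (2F , false ∷ true ∷ false ∷ [] , refl) = # 10 , refl
edge-surjective (2F , true ∷ true ∷ false ∷ [] , refl) = # 11 , refl
edge-surjective (0F , true ∷ _ , ())
edge-surjective (1F , _ ∷ true ∷ _ , ())
edge-surjective (2F , _ ∷ _ ∷ true ∷ [] , ())

edge-injective : ∀ a b → edge a ≡ edge b → a ≡ b
edge-injective = toWitness {a? = all? λ a → all? λ b → edge a ≟ᴱ edge b →-dec a ≟ᶠ b} _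

colourings : Vec (Vec (Fin 3) 12) 24
colourings =
  (0F ∷ 0F ∷ 0F ∷ 0F ∷ 1F ∷ 1F ∷ 1F ∷ 1F ∷ 2F ∷ 2F ∷ 2F ∷ 2F ∷ []) ∷
  (0F ∷ 0F ∷ 0F ∷ 0F ∷ 1F ∷ 2F ∷ 1F ∷ 2F ∷ 2F ∷ 1F ∷ 2F ∷ 1F ∷ []) ∷
  (0F ∷ 0F ∷ 0F ∷ 0F ∷ 2F ∷ 1F ∷ 2F ∷ 1F ∷ 1F ∷ 2F ∷ 1F ∷ 2F ∷ []) ∷
  (0F ∷ 0F ∷ 0F ∷ 0F ∷ 2F ∷ 2F ∷ 2F ∷ 2F ∷ 1F ∷ 1F ∷ 1F ∷ 1F ∷ []) ∷
  (0F ∷ 0F ∷ 1F ∷ 1F ∷ 1F ∷ 1F ∷ 0F ∷ 0F ∷ 2F ∷ 2F ∷ 2F ∷ 2F ∷ []) ∷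
  (0F ∷ 0F ∷ 2F ∷ 2F ∷ 2F ∷ 2F ∷ 0F ∷ 0F ∷ 1F ∷ 1F ∷ 1F ∷ 1F ∷ []) ∷
  (0F ∷ 1F ∷ 0F ∷ 1F ∷ 2F ∷ 2F ∷ 2F ∷ 2F ∷ 1F ∷ 1F ∷ 0F ∷ 0F ∷ []) ∷
  (0F ∷ 2F ∷ 0F ∷ 2F ∷ 1F ∷ 1F ∷ 1F ∷ 1F ∷ 2F ∷ 2F ∷ 0F ∷ 0F ∷ []) ∷
  (1F ∷ 0F ∷ 1F ∷ 0F ∷ 2F ∷ 2F ∷ 2F ∷ 2F ∷ 0F ∷ 0F ∷ 1F ∷ 1F ∷ []) ∷
  (1F ∷ 1F ∷ 0F ∷ 0F ∷ 0F ∷ 0F ∷ 1F ∷ 1F ∷ 2F ∷ 2F ∷ 2F ∷ 2F ∷ []) ∷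
  (1F ∷ 1F ∷ 1F ∷ 1F ∷ 0F ∷ 0F ∷ 0F ∷ 0F ∷ 2F ∷ 2F ∷ 2F ∷ 2F ∷ []) ∷
  (1F ∷ 1F ∷ 1F ∷ 1F ∷ 0F ∷ 2F ∷ 0F ∷ 2F ∷ 2F ∷ 0F ∷ 2F ∷ 0F ∷ []) ∷
  (1F ∷ 1F ∷ 1F ∷ 1F ∷ 2F ∷ 0F ∷ 2F ∷ 0F ∷ 0F ∷ 2F ∷ 0F ∷ 2F ∷ []) ∷
  (1F ∷ 1F ∷ 1F ∷ 1F ∷ 2F ∷ 2F ∷ 2F ∷ 2F ∷ 0F ∷ 0F ∷ 0F ∷ 0F ∷ []) ∷
  (1F ∷ 1F ∷ 2F ∷ 2F ∷ 2F ∷ 2F ∷ 1F ∷ 1F ∷ 0F ∷ 0F ∷ 0F ∷ 0F ∷ []) ∷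
  (1F ∷ 2F ∷ 1F ∷ 2F ∷ 0F ∷ 0F ∷ 0F ∷ 0F ∷ 2F ∷ 2F ∷ 1F ∷ 1F ∷ []) ∷
  (2F ∷ 0F ∷ 2F ∷ 0F ∷ 1F ∷ 1F ∷ 1F ∷ 1F ∷ 0F ∷ 0F ∷ 2F ∷ 2F ∷ []) ∷
  (2F ∷ 1F ∷ 2F ∷ 1F ∷ 0F ∷ 0F ∷ 0F ∷ 0F ∷ 1F ∷ 1F ∷ 2F ∷ 2F ∷ []) ∷
  (2F ∷ 2F ∷ 0F ∷ 0F ∷ 0F ∷ 0F ∷ 2F ∷ 2F ∷ 1F ∷ 1F ∷ 1F ∷ 1F ∷ []) ∷
  (2F ∷ 2F ∷ 1F ∷ 1F ∷ 1F ∷ 1F ∷ 2F ∷ 2F ∷ 0F ∷ 0F ∷ 0F ∷ 0F ∷ []) ∷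
  (2F ∷ 2F ∷ 2F ∷ 2F ∷ 0F ∷ 0F ∷ 0F ∷ 0F ∷ 1F ∷ 1F ∷ 1F ∷ 1F ∷ []) ∷
  (2F ∷ 2F ∷ 2F ∷ 2F ∷ 0F ∷ 1F ∷ 0F ∷ 1F ∷ 1F ∷ 0F ∷ 1F ∷ 0F ∷ []) ∷
  (2F ∷ 2F ∷ 2F ∷ 2F ∷ 1F ∷ 0F ∷ 1F ∷ 0F ∷ 0F ∷ 1F ∷ 0F ∷ 1F ∷ []) ∷
  (2F ∷ 2F ∷ 2F ∷ 2F ∷ 1F ∷ 1F ∷ 1F ∷ 1F ∷ 0F ∷ 0F ∷ 0F ∷ 0F ∷ []) ∷ []

neighbours : Vec (List ℕ) 12
neighbours =
  (4 ∷ 5 ∷ 8 ∷ 9 ∷ []) ∷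
  (4 ∷ 5 ∷ 10 ∷ 11 ∷ []) ∷
  (6 ∷ 7 ∷ 8 ∷ 9 ∷ []) ∷
  (6 ∷ 7 ∷ 10 ∷ 11 ∷ []) ∷
  (0 ∷ 1 ∷ 8 ∷ 10 ∷ []) ∷
  (0 ∷ 1 ∷ 9 ∷ 11 ∷ []) ∷
  (2 ∷ 3 ∷ 8 ∷ 10 ∷ []) ∷
  (2 ∷ 3 ∷ 9 ∷ 11 ∷ []) ∷
  (0 ∷ 2 ∷ 4 ∷ 6 ∷ []) ∷
  (0 ∷ 2 ∷ 5 ∷ 7 ∷ []) ∷
  (1 ∷ 3 ∷ 4 ∷ 6 ∷ []) ∷
  (1 ∷ 3 ∷ 5 ∷ 7 ∷ []) ∷ []

atDistance1 : Vec (List ℕ) 12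
atDistance1 =
  (1 ∷ 2 ∷ 6 ∷ 7 ∷ 10 ∷ 11 ∷ []) ∷
  (0 ∷ 3 ∷ 6 ∷ 7 ∷ 8 ∷ 9 ∷ []) ∷
  (0 ∷ 3 ∷ 4 ∷ 5 ∷ 10 ∷ 11 ∷ []) ∷
  (1 ∷ 2 ∷ 4 ∷ 5 ∷ 8 ∷ 9 ∷ []) ∷
  (2 ∷ 3 ∷ 5 ∷ 6 ∷ 9 ∷ 11 ∷ []) ∷
  (2 ∷ 3 ∷ 4 ∷ 7 ∷ 8 ∷ 10 ∷ []) ∷
  (0 ∷ 1 ∷ 4 ∷ 7 ∷ 9 ∷ 11 ∷ []) ∷
  (0 ∷ 1 ∷ 5 ∷ 6 ∷ 8 ∷ 10 ∷ []) ∷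
  (1 ∷ 3 ∷ 5 ∷ 7 ∷ 9 ∷ 10 ∷ []) ∷
  (1 ∷ 3 ∷ 4 ∷ 6 ∷ 8 ∷ 11 ∷ []) ∷
  (0 ∷ 2 ∷ 5 ∷ 7 ∷ 8 ∷ 11 ∷ []) ∷
  (0 ∷ 2 ∷ 4 ∷ 6 ∷ 9 ∷ 10 ∷ []) ∷ []

colouring : Fin 24 → Fin 12 → Fin 3
colouring n = lookup (lookup colourings n)

colouring-proper : ∀ n a b → AdjEdges (edge a) (edge b) → colouring n a ≢ colouring n b
colouring-proper = toWitness {a? = all? λ n → all? λ a → all? λ b →
  adjEdges? (edge a) (edge b) →-dec ¬? (colouring n a ≟ᶠ colouring n b)} _

Listed : Vec (List ℕ) 12 → Fin 12 → Fin 12 → Set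
Listed table a b = toℕ b ∈ lookup table a

listed? : ∀ table a b → Dec (Listed table a b)
listed? table a b = Any.any? (toℕ b ℕ.≟_) (lookup table a)

neighbours-adjEdges : ∀ a b → Listed neighbours a b → AdjEdges (edge a) (edge b)
neighbours-adjEdges = toWitness {a? = all? λ a → all? λ b →
  listed? neighbours a b →-dec adjEdges? (edge a) (edge b)} _

atDistance1-dist1 : ∀ a b → Listed atDistance1 a b → Dist1 (edge a) (edge b)
atDistance1-dist1 = toWitness {a? = all? λ a → all? λ b →
  listed? atDistance1 a b →-dec dist1? (edge a) (edge b)} _

Fact : Set
Fact = Fin 12 × Fin 3

_≟ᶠᵃ_ : DecidableEquality Fact
_≟ᶠᵃ_ = Product.≡-dec _≟ᶠ_ _≟ᶠ_

_∈?_ : ∀ f facts → Dec (f ∈ facts)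
f ∈? facts = Any.any? (f ≟ᶠᵃ_) facts

Excluded : List Fact → List Fact → Fact → Set
Excluded holding failing (a , c) =
  (a , c) ∈ failing ⊎
  Any (λ (a′ , c′) → a′ ≡ a × c′ ≢ c) holding ⊎
  Any (λ (b , c′) → c′ ≡ c × Listed neighbours a b) holding

excluded? : ∀ holding failing f → Dec (Excluded holding failing f)
excluded? holding failing (a , c) =
  (a , c) ∈? failing ⊎-dec
  Any.any? (λ (a′ , c′) → a′ ≟ᶠ a ×-dec ¬? (c′ ≟ᶠ c)) holding ⊎-dec
  Any.any? (λ (b , c′) → c′ ≟ᶠ c ×-dec listed? neighbours a b) holding

Clash : List Fact → Fin 12 → Fin 12 → Fin 12 → Fin 3 → Set
Clash holding a b b′ c =
  Listed atDistance1 a b × Listed atDistance1 a b′ × b ≢ b′ ×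
  (a , c) ∈ holding × (b , c) ∈ holding × (b′ , c) ∈ holding

clash? : ∀ holding a b b′ c → Dec (Clash holding a b b′ c)
clash? holding a b b′ c =
  listed? atDistance1 a b ×-dec listed? atDistance1 a b′ ×-dec ¬? (b ≟ᶠ b′) ×-dec
  (a , c) ∈? holding ×-dec (b , c) ∈? holding ×-dec (b′ , c) ∈? holding

-- A decision tree over facts φ (edge a) ≡ just c: split a c branches on whether the fact holds,
-- done n claims that colouring n avoids φ by the facts of its branch, and clash a b b′ c that
-- these facts give edge a two distinct partners b, b′ at distance 1 of its colour c. Numbers are
-- read modulo the sizes of the tables they index.
data Certificate : Set where
  split : (a c : ℕ) → Certificate → Certificate → Certificate
  done  : (n : ℕ) → Certificate
  clash : (a b b′ c : ℕ) → Certificate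

valid : List Fact → List Fact → Certificate → Bool
valid holding failing (split a c t u) =
  valid ((a mod 12 , c mod 3) ∷ holding) failing t ∧ valid holding ((a mod 12 , c mod 3) ∷ failing) u
valid holding failing (done n) =
  ⌊ all? (λ a → excluded? holding failing (a , colouring (n mod 24) a)) ⌋
valid holding failing (clash a b b′ c) =
  ⌊ clash? holding (a mod 12) (b mod 12) (b′ mod 12) (c mod 3) ⌋

module _ (φ : PartialColoring 3) (proper : IsProperPartial φ) (tame : AtMostOneSameColorAtDist1 φ) where

  Holds : Fact → Set
  Holds (a , c) = φ (edge a) ≡ just c

  excluded⇒¬holds : ∀ {holding failing a c} → All Holds holding → All (¬_ ∘ Holds) failing →
                    Excluded holding failing (a , c) → ¬ Holds (a , c)
  excluded⇒¬holds _ ⊨failing (inj₁ f∈failing) = All.lookup ⊨failing f∈failing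
  excluded⇒¬holds ⊨holding _ (inj₂ (inj₁ recoloured)) φa≡c = All.lookupWith
    (λ { φa≡c′ (refl , c′≢c) → c′≢c (Maybe.just-injective (trans (sym φa≡c′) φa≡c)) })
    ⊨holding recoloured
  excluded⇒¬holds {a = a} ⊨holding _ (inj₂ (inj₂ blocked)) φa≡c = All.lookupWith
    (λ { φb≡c (refl , ab) → proper _ _ _ (neighbours-adjEdges a _ ab) φa≡c φb≡c })
    ⊨holding blocked

  clash⇒⊥ : ∀ {holding a b b′ c} → All Holds holding → ¬ Clash holding a b b′ c
  clash⇒⊥ {a = a} {b} {b′} {c} ⊨holding (ab , ab′ , b≢b′ , a∈ , b∈ , b′∈) =
    b≢b′ (edge-injective b b′ (tame (edge a) (edge b) (edge b′) c
      (All.lookup ⊨holding a∈) (All.lookup ⊨holding b∈) (All.lookup ⊨holding b′∈)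
      (atDistance1-dist1 a b ab) (atDistance1-dist1 a b′ ab′)))

  valid⇒avoiding : ∀ holding failing t → T (valid holding failing t) →
                   All Holds holding → All (¬_ ∘ Holds) failing →
                   ∃[ n ] ∀ a → ¬ Holds (a , colouring n a)
  valid⇒avoiding holding failing (split a c t u) ok ⊨holding ⊨failing
    with Equivalence.to Bool.T-∧ ok | Maybe.≡-dec _≟ᶠ_ (φ (edge (a mod 12))) (just (c mod 3))
  ... | ok-t , _ | yes holds = valid⇒avoiding _ _ t ok-t (holds ∷ ⊨holding) ⊨failing
  ... | _ , ok-u | no fails  = valid⇒avoiding _ _ u ok-u ⊨holding (fails ∷ ⊨failing)
  valid⇒avoiding holding failing (done n) ok ⊨holding ⊨failing =
    n mod 24 , λ a → excluded⇒¬holds ⊨holding ⊨failing (toWitness ok a)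
  valid⇒avoiding holding failing (clash a b b′ c) ok ⊨holding _ =
    ⊥-elim (clash⇒⊥ ⊨holding (toWitness ok))

certificate : Certificate
certificate =
  (split 0 0 (split 1 0 (split 2 1 (split 3 2 (split 8 2 (split 6 0 (clash 0 1 6 0) (split 7 0 (clash 0 1 7 0)
  (done 17))) (split 9 2 (split 6 0 (clash 0 1 6 0) (split 7 0 (clash 0 1 7 0) (done 17))) (done 9)))
  (split 4 2 (split 5 1 (split 7 0 (clash 0 1 7 0) (done 22)) (done 23)) (split 5 2 (split 4 1 (split 6 0
  (clash 0 1 6 0) (done 21)) (done 23)) (done 14)))) (split 3 1 (split 2 2 (split 10 2 (split 6 0
  (clash 0 1 6 0) (split 7 0 (clash 0 1 7 0) (done 15))) (split 11 2 (split 6 0 (clash 0 1 6 0) (split 7 0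
  (clash 0 1 7 0) (done 15))) (done 9))) (split 4 2 (split 5 1 (split 7 0 (clash 0 1 7 0) (done 22))
  (done 23)) (split 5 2 (split 4 1 (split 6 0 (clash 0 1 6 0) (done 21)) (done 23)) (done 14)))) (split 4 2
  (split 5 2 (split 6 0 (clash 0 1 6 0) (split 7 0 (clash 0 1 7 0) (done 10))) (split 6 0 (clash 0 1 6 0)
  (split 7 2 (done 10) (done 11)))) (split 5 2 (split 6 2 (split 7 0 (clash 0 1 7 0) (done 10)) (split 7 0
  (clash 0 1 7 0) (done 12))) (split 6 2 (split 7 2 (done 10) (done 11)) (split 7 2 (done 12) (done 13)))))))
  (split 2 1 (split 3 0 (split 1 1 (done 20) (split 4 2 (split 11 2 (done 22) (done 17)) (split 5 2
  (split 10 2 (done 21) (done 17)) (done 14)))) (split 4 1 (split 8 2 (split 1 2 (split 3 2 (clash 8 1 3 2)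
  (split 10 0 (split 3 1 (clash 2 4 3 1) (split 7 0 (clash 0 10 7 0) (done 17))) (split 11 0 (split 3 1
  (clash 2 4 3 1) (split 6 0 (clash 0 11 6 0) (done 17))) (done 14)))) (split 7 2 (split 6 0 (split 5 2
  (clash 8 7 5 2) (split 11 0 (clash 0 6 11 0) (done 14))) (split 11 1 (clash 2 4 11 1) (done 20)))
  (split 11 1 (clash 2 4 11 1) (done 18)))) (split 9 2 (split 3 2 (split 6 0 (split 1 2 (clash 9 3 1 2)
  (split 11 1 (clash 2 4 11 1) (done 18))) (split 7 0 (split 1 2 (clash 9 3 1 2) (split 11 1 (clash 2 4 11 1)
  (done 18))) (done 17))) (split 10 0 (split 3 1 (clash 2 4 3 1) (split 7 0 (clash 0 10 7 0) (split 11 2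
  (done 20) (done 17)))) (split 11 0 (split 1 2 (split 3 1 (clash 2 4 3 1) (split 6 0 (clash 0 11 6 0)
  (done 17))) (split 6 2 (done 20) (done 18))) (done 14)))) (split 10 2 (split 5 2 (split 7 2 (clash 10 5 7 2)
  (split 11 1 (clash 2 4 11 1) (done 18))) (split 11 0 (split 7 2 (split 6 0 (clash 0 11 6 0) (done 20))
  (done 18)) (done 14))) (split 11 2 (split 10 0 (split 6 2 (split 7 0 (clash 0 10 7 0) (done 20)) (done 18))
  (done 14)) (done 9))))) (split 5 1 (split 8 2 (split 3 2 (split 6 0 (split 1 2 (clash 8 3 1 2) (split 10 1
  (clash 2 5 10 1) (done 18))) (split 7 0 (split 1 2 (clash 8 3 1 2) (split 10 1 (clash 2 5 10 1) (done 18)))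
  (done 17))) (split 10 0 (split 1 2 (split 3 1 (clash 2 5 3 1) (split 7 0 (clash 0 10 7 0) (done 17)))
  (split 7 2 (done 20) (done 18))) (split 11 0 (split 1 2 (split 3 1 (clash 2 5 3 1) (split 6 0
  (clash 0 11 6 0) (done 17))) (done 22)) (done 14)))) (split 9 2 (split 1 2 (split 3 2 (clash 9 1 3 2)
  (split 10 0 (split 3 1 (clash 2 5 3 1) (split 7 0 (clash 0 10 7 0) (done 17))) (split 11 0 (split 3 1
  (clash 2 5 3 1) (split 6 0 (clash 0 11 6 0) (done 17))) (done 14)))) (split 6 2 (split 7 0 (split 4 2
  (clash 9 6 4 2) (split 10 0 (clash 0 7 10 0) (done 14))) (split 10 1 (clash 2 5 10 1) (done 20)))
  (split 10 1 (clash 2 5 10 1) (done 18)))) (split 10 2 (split 11 0 (done 22) (done 14)) (split 11 2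
  (split 4 2 (split 6 2 (clash 11 4 6 2) (split 10 1 (clash 2 5 10 1) (done 18))) (split 10 0 (split 6 2
  (split 7 0 (clash 0 10 7 0) (done 20)) (done 18)) (done 14))) (done 9))))) (split 10 2 (split 11 0 (done 22)
  (done 23)) (split 11 2 (split 10 0 (done 21) (done 23)) (done 16)))))) (split 3 0 (split 1 1 (split 8 2
  (split 7 2 (done 21) (done 19)) (split 9 2 (split 6 2 (done 22) (done 19)) (done 15))) (split 8 2 (split 9 2
  (done 13) (split 11 2 (done 13) (done 12))) (split 9 2 (split 10 2 (done 13) (done 11)) (split 10 2
  (split 11 2 (done 13) (done 12)) (split 11 2 (done 11) (done 10)))))) (split 4 2 (split 2 2 (split 1 1
  (split 8 1 (split 3 2 (clash 4 2 3 2) (split 6 0 (split 3 1 (clash 1 8 3 1) (split 11 0 (clash 0 6 11 0)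
  (done 19))) (split 7 0 (split 3 1 (clash 1 8 3 1) (split 10 0 (clash 0 7 10 0) (done 19))) (done 15))))
  (split 9 1 (split 3 2 (clash 4 2 3 2) (split 6 0 (split 3 1 (clash 1 9 3 1) (split 11 0 (clash 0 6 11 0)
  (done 19))) (split 7 0 (split 3 1 (clash 1 9 3 1) (split 10 0 (clash 0 7 10 0) (done 19))) (done 15))))
  (done 18))) (split 6 1 (split 7 0 (split 5 2 (clash 4 2 5 2) (done 11)) (split 11 2 (clash 4 2 11 2)
  (done 10))) (split 7 1 (split 6 0 (split 8 1 (split 5 1 (clash 7 8 5 1) (split 11 0 (clash 0 6 11 0)
  (done 19))) (split 10 1 (split 5 1 (clash 7 10 5 1) (split 11 0 (clash 0 6 11 0) (done 19))) (done 18)))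
  (split 11 2 (clash 4 2 11 2) (done 10))) (split 11 2 (clash 4 2 11 2) (done 9))))) (split 5 1 (split 3 1
  (split 7 0 (split 9 2 (split 6 2 (clash 4 9 6 2) (split 8 1 (clash 5 3 8 1) (done 18))) (split 11 2
  (split 6 2 (clash 4 11 6 2) (split 8 1 (clash 5 3 8 1) (done 18))) (done 9))) (split 10 0 (split 9 2
  (split 8 1 (clash 5 3 8 1) (done 20)) (done 15)) (done 22))) (split 6 0 (split 3 2 (split 7 1 (split 8 1
  (clash 5 7 8 1) (split 10 1 (clash 5 7 10 1) (done 18))) (split 9 2 (clash 4 3 9 2) (done 9))) (split 7 0
  (clash 0 6 7 0) (done 22))) (split 7 2 (done 10) (split 11 0 (split 9 2 (split 8 1 (split 3 2
  (clash 4 9 3 2) (split 10 0 (clash 0 11 10 0) (done 22))) (done 17)) (done 10)) (done 11))))) (split 6 1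
  (split 7 2 (split 1 1 (done 15) (done 10)) (split 10 0 (split 1 1 (split 2 0 (clash 0 10 2 0) (split 9 1
  (clash 6 1 9 1) (done 18))) (split 5 2 (split 7 0 (clash 0 10 7 0) (done 10)) (split 11 0 (clash 0 10 11 0)
  (done 11)))) (split 11 0 (split 1 1 (split 3 2 (split 2 0 (clash 0 11 2 0) (split 9 1 (clash 6 1 9 1)
  (done 18))) (split 9 2 (done 20) (done 15))) (split 9 2 (done 17) (done 10))) (done 19)))) (split 7 1
  (split 3 2 (split 10 0 (split 1 1 (split 2 0 (clash 0 10 2 0) (split 8 1 (clash 7 1 8 1) (done 18)))
  (split 9 2 (clash 4 3 9 2) (done 10))) (split 11 0 (split 1 1 (split 2 0 (clash 0 11 2 0) (split 8 1
  (clash 7 1 8 1) (done 18))) (split 6 0 (clash 0 11 6 0) (split 9 2 (clash 4 3 9 2) (done 10)))) (done 19)))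
  (split 10 0 (split 9 2 (split 8 1 (split 1 1 (clash 7 8 1 1) (split 11 0 (clash 0 10 11 0) (done 11)))
  (done 20)) (done 15)) (done 22))) (split 11 2 (split 10 0 (split 8 1 (split 1 1 (split 7 0 (clash 0 10 7 0)
  (split 9 2 (clash 4 11 9 2) (done 15))) (split 3 1 (split 7 0 (clash 0 10 7 0) (split 9 2 (clash 4 11 9 2)
  (done 15))) (done 11))) (done 21)) (done 23)) (done 16)))))) (split 5 2 (split 1 1 (split 3 2 (split 10 0
  (split 2 2 (clash 5 3 2 2) (split 6 1 (split 2 0 (clash 0 10 2 0) (split 9 1 (clash 1 6 9 1) (done 18)))
  (split 7 1 (split 2 0 (clash 0 10 2 0) (split 8 1 (clash 1 7 8 1) (done 18))) (done 16)))) (split 11 0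
  (split 2 2 (clash 5 3 2 2) (split 6 1 (split 2 0 (clash 0 11 2 0) (split 9 1 (clash 1 6 9 1) (done 18)))
  (split 7 1 (split 2 0 (clash 0 11 2 0) (split 8 1 (clash 1 7 8 1) (done 18))) (done 16)))) (done 19)))
  (split 6 0 (split 2 2 (split 8 1 (split 3 1 (clash 1 8 3 1) (split 11 0 (clash 0 6 11 0) (done 19)))
  (split 9 1 (split 3 1 (clash 1 9 3 1) (split 11 0 (clash 0 6 11 0) (done 19))) (done 18))) (split 7 1
  (done 22) (split 10 2 (split 11 0 (clash 0 6 11 0) (done 23)) (done 16)))) (split 7 0 (split 2 2 (split 8 1
  (split 3 1 (clash 1 8 3 1) (split 10 0 (clash 0 7 10 0) (done 19))) (split 9 1 (split 3 1 (clash 1 9 3 1)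
  (split 10 0 (clash 0 7 10 0) (done 19))) (done 18))) (split 8 1 (split 10 2 (done 23) (done 16)) (done 21)))
  (split 8 2 (split 9 1 (split 11 0 (split 6 1 (clash 1 9 6 1) (split 10 2 (clash 5 8 10 2) (done 16)))
  (done 21)) (done 20)) (done 15))))) (split 3 1 (split 2 0 (split 8 2 (split 9 1 (split 11 0 (clash 0 2 11 0)
  (done 21)) (done 20)) (done 15)) (split 8 2 (split 4 1 (split 7 2 (clash 5 8 7 2) (split 9 1 (clash 3 4 9 1)
  (done 18))) (split 10 2 (clash 5 8 10 2) (done 16))) (split 10 2 (split 6 0 (split 7 2 (clash 5 10 7 2)
  (split 8 1 (split 2 2 (clash 5 10 2 2) (split 11 0 (clash 0 6 11 0) (done 23))) (split 9 1 (split 2 2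
  (clash 5 10 2 2) (split 4 1 (clash 3 9 4 1) (split 11 0 (clash 0 6 11 0) (done 23)))) (done 18))))
  (split 7 0 (split 8 1 (split 2 2 (clash 5 10 2 2) (done 23)) (split 9 1 (split 2 2 (clash 5 10 2 2)
  (done 21)) (done 18))) (done 15))) (done 9)))) (split 6 2 (split 7 0 (done 9) (done 10)) (split 7 0
  (split 4 1 (split 9 1 (split 6 1 (clash 4 9 6 1) (split 8 2 (split 3 2 (clash 5 8 3 2) (split 6 0
  (clash 0 7 6 0) (done 21))) (split 10 2 (split 2 2 (clash 5 10 2 2) (split 6 0 (clash 0 7 6 0) (done 21)))
  (done 9)))) (split 11 1 (split 6 1 (clash 4 11 6 1) (split 8 2 (split 3 2 (clash 5 8 3 2) (split 6 0
  (clash 0 7 6 0) (done 21))) (split 10 2 (split 2 2 (clash 5 10 2 2) (split 6 0 (clash 0 7 6 0) (done 21)))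
  (done 9)))) (done 18))) (split 10 0 (clash 0 7 10 0) (done 19))) (split 10 0 (split 8 2 (split 9 1
  (split 4 1 (split 3 2 (clash 5 8 3 2) (split 11 0 (clash 0 10 11 0) (done 21))) (split 6 1 (split 3 2
  (clash 5 8 3 2) (split 11 0 (clash 0 10 11 0) (done 21))) (done 16))) (done 17)) (done 10)) (done 12))))))
  (split 6 2 (split 1 1 (split 7 0 (split 11 2 (split 8 1 (split 10 0 (clash 0 7 10 0) (done 23)) (done 21))
  (done 16)) (split 9 2 (split 8 1 (split 10 0 (split 7 1 (clash 1 8 7 1) (split 11 2 (clash 6 9 11 2)
  (done 16))) (done 22)) (done 20)) (done 15))) (split 3 1 (split 10 0 (split 2 0 (clash 0 10 2 0) (split 9 2
  (split 4 1 (split 1 2 (clash 6 9 1 2) (split 7 0 (clash 0 10 7 0) (done 20))) (split 5 1 (split 1 2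
  (clash 6 9 1 2) (split 7 0 (clash 0 10 7 0) (split 8 1 (clash 3 5 8 1) (done 20)))) (split 11 2
  (clash 6 9 11 2) (done 16)))) (split 11 2 (split 7 0 (clash 0 10 7 0) (done 15)) (done 9)))) (split 11 0
  (split 2 0 (clash 0 11 2 0) (split 9 2 (split 4 1 (split 1 2 (clash 6 9 1 2) (done 20)) (split 5 1
  (split 1 2 (clash 6 9 1 2) (done 22)) (done 16))) (done 9))) (done 14))) (split 7 2 (done 10) (split 11 0
  (split 9 2 (split 8 1 (split 5 1 (split 1 2 (clash 6 9 1 2) (split 10 0 (clash 0 11 10 0) (done 22)))
  (split 7 1 (split 1 2 (clash 6 9 1 2) (split 10 0 (clash 0 11 10 0) (done 22))) (done 16))) (done 17))
  (done 10)) (done 11))))) (split 7 2 (split 1 1 (split 6 0 (split 10 2 (split 9 1 (split 11 0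
  (clash 0 6 11 0) (done 23)) (done 22)) (done 16)) (split 8 2 (split 9 1 (split 11 0 (split 6 1
  (clash 1 9 6 1) (split 10 2 (clash 7 8 10 2) (done 16))) (done 21)) (done 20)) (done 15))) (split 3 1
  (split 10 0 (split 2 0 (clash 0 10 2 0) (split 8 2 (split 4 1 (split 1 2 (clash 7 8 1 2) (split 9 1
  (clash 3 4 9 1) (done 20))) (split 5 1 (split 1 2 (clash 7 8 1 2) (done 20)) (done 16))) (done 9)))
  (split 11 0 (split 2 0 (clash 0 11 2 0) (split 8 2 (split 4 1 (split 1 2 (clash 7 8 1 2) (split 6 0
  (clash 0 11 6 0) (split 9 1 (clash 3 4 9 1) (done 20)))) (split 5 1 (split 1 2 (clash 7 8 1 2) (done 22))
  (split 10 2 (clash 7 8 10 2) (done 16)))) (split 10 2 (split 6 0 (clash 0 11 6 0) (done 15)) (done 9))))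
  (done 14))) (split 10 0 (split 8 2 (split 9 1 (split 4 1 (split 1 2 (clash 7 8 1 2) (split 11 0
  (clash 0 10 11 0) (done 21))) (split 6 1 (split 1 2 (clash 7 8 1 2) (split 11 0 (clash 0 10 11 0)
  (done 21))) (done 16))) (done 17)) (done 10)) (done 12)))) (split 10 1 (split 11 0 (split 9 2 (split 5 1
  (split 6 0 (clash 0 11 6 0) (split 8 1 (clash 10 5 8 1) (done 17))) (split 7 1 (split 6 0 (clash 0 11 6 0)
  (split 8 1 (clash 10 7 8 1) (done 17))) (done 16))) (done 12)) (done 13)) (split 11 1 (split 10 0 (split 8 2
  (split 4 1 (split 7 0 (clash 0 10 7 0) (split 9 1 (clash 11 4 9 1) (done 17))) (split 6 1 (split 7 0
  (clash 0 10 7 0) (split 9 1 (clash 11 6 9 1) (done 17))) (done 16))) (done 11)) (done 13)) (done 8))))))))))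
  (split 1 0 (split 2 0 (split 0 1 (split 3 1 (done 20) (split 10 2 (split 7 2 (done 21) (done 19))
  (split 11 2 (split 6 2 (done 22) (done 19)) (done 17)))) (split 3 1 (split 4 2 (split 9 2 (done 22)
  (done 15)) (split 5 2 (split 8 2 (done 21) (done 15)) (done 14))) (split 8 2 (split 9 2 (done 13)
  (split 11 2 (done 13) (done 12))) (split 9 2 (split 10 2 (done 13) (done 11)) (split 10 2 (split 11 2
  (done 13) (done 12)) (split 11 2 (done 11) (done 10))))))) (split 3 1 (split 4 1 (split 8 2 (split 5 2
  (split 7 2 (clash 8 5 7 2) (split 9 1 (clash 3 4 9 1) (done 18))) (split 9 0 (split 7 2 (split 6 0
  (clash 1 9 6 0) (done 20)) (done 18)) (done 14))) (split 9 2 (split 8 0 (split 6 2 (split 7 0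
  (clash 1 8 7 0) (done 20)) (done 18)) (done 14)) (split 10 2 (split 2 1 (clash 3 4 2 1) (split 6 0
  (split 2 2 (split 0 2 (clash 10 2 0 2) (split 9 1 (clash 3 4 9 1) (done 18))) (split 5 2 (split 7 2
  (clash 10 5 7 2) (split 9 1 (clash 3 4 9 1) (done 18))) (split 9 0 (clash 1 6 9 0) (done 14)))) (split 7 0
  (split 0 2 (split 2 2 (clash 10 0 2 2) (split 8 0 (clash 1 7 8 0) (done 14))) (split 9 1 (clash 3 4 9 1)
  (done 18))) (done 15)))) (split 11 2 (split 2 2 (split 6 0 (split 0 2 (clash 11 2 0 2) (split 9 1
  (clash 3 4 9 1) (done 18))) (split 7 0 (split 0 2 (clash 11 2 0 2) (split 9 1 (clash 3 4 9 1) (done 18)))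
  (done 15))) (split 8 0 (split 2 1 (clash 3 4 2 1) (split 7 0 (clash 1 8 7 0) (done 15))) (split 9 0
  (split 2 1 (clash 3 4 2 1) (split 6 0 (clash 1 9 6 0) (done 15))) (done 14)))) (done 9))))) (split 5 1
  (split 8 2 (split 9 0 (done 22) (done 14)) (split 9 2 (split 4 2 (split 6 2 (clash 9 4 6 2) (split 8 1
  (clash 3 5 8 1) (done 18))) (split 8 0 (split 6 2 (split 7 0 (clash 1 8 7 0) (done 20)) (done 18))
  (done 14))) (split 10 2 (split 2 2 (split 6 0 (split 0 2 (clash 10 2 0 2) (split 8 1 (clash 3 5 8 1)
  (done 18))) (split 7 0 (split 0 2 (clash 10 2 0 2) (split 8 1 (clash 3 5 8 1) (done 18))) (done 15)))
  (split 8 0 (split 2 1 (clash 3 5 2 1) (split 7 0 (clash 1 8 7 0) (done 15))) (split 9 0 (split 0 2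
  (split 2 1 (clash 3 5 2 1) (split 6 0 (clash 1 9 6 0) (done 15))) (done 22)) (done 14)))) (split 11 2
  (split 2 1 (clash 3 5 2 1) (split 6 0 (split 0 2 (split 2 2 (clash 11 0 2 2) (split 9 0 (clash 1 6 9 0)
  (done 14))) (split 8 1 (clash 3 5 8 1) (done 18))) (split 7 0 (split 2 2 (split 0 2 (clash 11 2 0 2)
  (split 8 1 (clash 3 5 8 1) (done 18))) (split 4 2 (split 6 2 (clash 11 4 6 2) (split 8 1 (clash 3 5 8 1)
  (done 18))) (split 8 0 (clash 1 7 8 0) (done 14)))) (done 15)))) (done 9))))) (split 8 2 (split 9 0
  (done 22) (done 23)) (split 9 2 (split 8 0 (done 21) (done 23)) (done 7))))) (split 4 2 (split 3 2
  (split 0 1 (split 10 1 (split 2 2 (clash 4 3 2 2) (split 6 0 (split 2 1 (clash 0 10 2 1) (split 9 0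
  (clash 1 6 9 0) (done 19))) (split 7 0 (split 2 1 (clash 0 10 2 1) (split 8 0 (clash 1 7 8 0) (done 19)))
  (done 17)))) (split 11 1 (split 2 2 (clash 4 3 2 2) (split 6 0 (split 2 1 (clash 0 11 2 1) (split 9 0
  (clash 1 6 9 0) (done 19))) (split 7 0 (split 2 1 (clash 0 11 2 1) (split 8 0 (clash 1 7 8 0) (done 19)))
  (done 17)))) (done 18))) (split 6 1 (split 7 0 (split 5 2 (clash 4 3 5 2) (done 11)) (split 9 2
  (clash 4 3 9 2) (done 10))) (split 7 1 (split 6 0 (split 8 1 (split 5 1 (clash 7 8 5 1) (split 9 0
  (clash 1 6 9 0) (done 19))) (split 10 1 (split 5 1 (clash 7 10 5 1) (split 9 0 (clash 1 6 9 0) (done 19)))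
  (done 18))) (split 9 2 (clash 4 3 9 2) (done 10))) (split 9 2 (clash 4 3 9 2) (done 9))))) (split 5 1
  (split 2 1 (split 7 0 (split 9 2 (split 6 2 (clash 4 9 6 2) (split 10 1 (clash 5 2 10 1) (done 18)))
  (split 11 2 (split 6 2 (clash 4 11 6 2) (split 10 1 (clash 5 2 10 1) (done 18))) (done 9))) (split 8 0
  (split 11 2 (split 10 1 (clash 5 2 10 1) (done 20)) (done 17)) (done 22))) (split 6 0 (split 2 2 (split 7 1
  (split 8 1 (clash 5 7 8 1) (split 10 1 (clash 5 7 10 1) (done 18))) (split 11 2 (clash 4 2 11 2) (done 9)))
  (split 7 0 (clash 1 6 7 0) (done 22))) (split 7 2 (done 10) (split 9 0 (split 11 2 (split 10 1 (split 2 2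
  (clash 4 11 2 2) (split 8 0 (clash 1 9 8 0) (done 22))) (done 15)) (done 10)) (done 11))))) (split 6 1
  (split 7 2 (split 0 1 (done 17) (done 10)) (split 8 0 (split 0 1 (split 3 0 (clash 1 8 3 0) (split 11 1
  (clash 6 0 11 1) (done 18))) (split 5 2 (split 7 0 (clash 1 8 7 0) (done 10)) (split 9 0 (clash 1 8 9 0)
  (done 11)))) (split 9 0 (split 0 1 (split 2 2 (split 3 0 (clash 1 9 3 0) (split 11 1 (clash 6 0 11 1)
  (done 18))) (split 11 2 (done 20) (done 17))) (split 11 2 (done 15) (done 10))) (done 19)))) (split 7 1
  (split 2 2 (split 8 0 (split 0 1 (split 3 0 (clash 1 8 3 0) (split 10 1 (clash 7 0 10 1) (done 18)))
  (split 11 2 (clash 4 2 11 2) (done 10))) (split 9 0 (split 0 1 (split 3 0 (clash 1 9 3 0) (split 10 1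
  (clash 7 0 10 1) (done 18))) (split 6 0 (clash 1 9 6 0) (split 11 2 (clash 4 2 11 2) (done 10))))
  (done 19))) (split 8 0 (split 11 2 (split 10 1 (split 0 1 (clash 7 10 0 1) (split 9 0 (clash 1 8 9 0)
  (done 11))) (done 20)) (done 17)) (done 22))) (split 9 2 (split 8 0 (split 10 1 (split 0 1 (split 7 0
  (clash 1 8 7 0) (split 11 2 (clash 4 9 11 2) (done 17))) (split 2 1 (split 7 0 (clash 1 8 7 0) (split 11 2
  (clash 4 9 11 2) (done 17))) (done 11))) (done 21)) (done 23)) (done 7)))))) (split 5 2 (split 3 2
  (split 0 1 (split 10 1 (split 2 2 (clash 5 3 2 2) (split 6 0 (split 2 1 (clash 0 10 2 1) (split 9 0
  (clash 1 6 9 0) (done 19))) (split 7 0 (split 2 1 (clash 0 10 2 1) (split 8 0 (clash 1 7 8 0) (done 19)))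
  (done 17)))) (split 11 1 (split 2 2 (clash 5 3 2 2) (split 6 0 (split 2 1 (clash 0 11 2 1) (split 9 0
  (clash 1 6 9 0) (done 19))) (split 7 0 (split 2 1 (clash 0 11 2 1) (split 8 0 (clash 1 7 8 0) (done 19)))
  (done 17)))) (done 18))) (split 6 1 (split 7 0 (split 9 1 (split 4 1 (clash 6 9 4 1) (split 8 0
  (clash 1 7 8 0) (done 19))) (split 11 1 (split 4 1 (clash 6 11 4 1) (split 8 0 (clash 1 7 8 0) (done 19)))
  (done 18))) (split 8 2 (clash 5 3 8 2) (done 10))) (split 7 1 (split 8 0 (done 10) (done 12)) (split 8 2
  (clash 5 3 8 2) (done 9))))) (split 4 1 (split 2 1 (split 6 0 (split 8 2 (split 7 2 (clash 5 8 7 2)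
  (split 11 1 (clash 4 2 11 1) (done 18))) (split 10 2 (split 7 2 (clash 5 10 7 2) (split 11 1
  (clash 4 2 11 1) (done 18))) (done 9))) (split 9 0 (split 10 2 (split 11 1 (clash 4 2 11 1) (done 20))
  (done 17)) (done 21))) (split 6 2 (split 7 0 (done 9) (done 10)) (split 7 0 (split 9 1 (split 2 2 (split 6 1
  (clash 4 9 6 1) (split 10 2 (clash 5 2 10 2) (done 9))) (split 6 0 (clash 1 7 6 0) (done 21))) (split 11 1
  (split 2 2 (split 6 1 (clash 4 11 6 1) (split 10 2 (clash 5 2 10 2) (done 9))) (split 6 0 (clash 1 7 6 0)
  (done 21))) (done 18))) (split 8 0 (split 10 2 (split 11 1 (split 2 2 (clash 5 10 2 2) (split 9 0
  (clash 1 8 9 0) (done 21))) (done 15)) (done 10)) (done 12))))) (split 6 1 (split 0 1 (split 2 2 (split 3 0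
  (split 8 0 (clash 1 3 8 0) (split 9 0 (clash 1 3 9 0) (done 19))) (split 11 1 (clash 6 0 11 1) (done 18)))
  (split 7 0 (done 21) (split 10 2 (split 11 1 (clash 6 0 11 1) (done 20)) (done 17)))) (split 7 0 (split 8 0
  (clash 1 7 8 0) (done 19)) (split 8 0 (split 10 2 (split 11 1 (split 2 2 (clash 5 10 2 2) (split 9 0
  (clash 1 8 9 0) (done 21))) (done 15)) (done 10)) (done 12)))) (split 7 1 (split 2 2 (split 0 1 (split 3 0
  (split 8 0 (clash 1 3 8 0) (split 9 0 (clash 1 3 9 0) (done 19))) (split 10 1 (clash 7 0 10 1) (done 18)))
  (split 8 0 (split 10 2 (clash 5 2 10 2) (done 10)) (done 12))) (split 8 0 (split 10 2 (done 20) (done 17))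
  (done 22))) (split 8 2 (split 9 0 (split 11 1 (split 0 1 (split 6 0 (clash 1 9 6 0) (split 10 2
  (clash 5 8 10 2) (done 17))) (split 2 1 (split 6 0 (clash 1 9 6 0) (split 10 2 (clash 5 8 10 2) (done 17)))
  (done 12))) (done 22)) (done 23)) (done 7)))))) (split 6 2 (split 4 1 (split 2 1 (split 8 0 (split 3 0
  (clash 1 8 3 0) (split 9 2 (split 5 1 (clash 4 2 5 1) (done 21)) (split 11 2 (split 0 2 (clash 6 11 0 2)
  (split 7 0 (clash 1 8 7 0) (done 20))) (done 9)))) (split 9 0 (split 3 0 (clash 1 9 3 0) (split 11 2
  (split 0 2 (clash 6 11 0 2) (done 20)) (done 9))) (done 14))) (split 7 2 (done 10) (split 9 0 (split 11 2
  (done 15) (done 10)) (done 11)))) (split 5 1 (split 2 1 (split 8 0 (split 3 0 (clash 1 8 3 0) (split 9 2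
  (split 7 0 (clash 1 8 7 0) (split 11 2 (clash 6 9 11 2) (done 17))) (split 11 2 (split 0 2 (clash 6 11 0 2)
  (split 7 0 (clash 1 8 7 0) (split 10 1 (clash 5 2 10 1) (done 20)))) (done 9)))) (split 9 0 (split 0 2
  (split 3 0 (clash 1 9 3 0) (split 11 2 (clash 6 0 11 2) (done 9))) (done 22)) (done 14))) (split 7 2
  (done 10) (split 9 0 (split 11 2 (split 10 1 (split 0 2 (clash 6 11 0 2) (split 8 0 (clash 1 9 8 0)
  (done 22))) (done 15)) (done 10)) (done 11)))) (split 7 1 (split 0 1 (split 11 2 (split 10 1
  (clash 7 0 10 1) (done 20)) (done 17)) (split 9 0 (split 11 2 (split 10 1 (split 0 2 (clash 6 11 0 2)
  (split 8 0 (clash 1 9 8 0) (done 22))) (done 15)) (done 10)) (done 11))) (split 9 2 (split 8 0 (split 10 1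
  (split 0 1 (split 7 0 (clash 1 8 7 0) (split 11 2 (clash 6 9 11 2) (done 17))) (split 2 1 (split 7 0
  (clash 1 8 7 0) (split 11 2 (clash 6 9 11 2) (done 17))) (done 11))) (done 21)) (done 23)) (done 7)))))
  (split 7 2 (split 0 1 (split 6 1 (split 10 2 (split 11 1 (clash 0 6 11 1) (done 20)) (done 17)) (split 8 2
  (split 11 1 (split 9 0 (split 6 0 (clash 1 9 6 0) (split 10 2 (clash 7 8 10 2) (done 17))) (done 23))
  (done 22)) (done 7))) (split 2 1 (split 8 0 (split 4 1 (split 3 0 (clash 1 8 3 0) (split 10 2 (split 0 2
  (clash 7 10 0 2) (split 11 1 (clash 2 4 11 1) (done 20))) (done 9))) (split 5 1 (split 3 0 (clash 1 8 3 0)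
  (split 10 2 (split 0 2 (clash 7 10 0 2) (done 20)) (done 9))) (done 7))) (split 9 0 (split 4 1 (split 3 0
  (clash 1 9 3 0) (split 8 2 (split 6 0 (clash 1 9 6 0) (split 10 2 (clash 7 8 10 2) (done 17))) (split 10 2
  (split 0 2 (clash 7 10 0 2) (split 6 0 (clash 1 9 6 0) (split 11 1 (clash 2 4 11 1) (done 20)))) (done 9))))
  (split 5 1 (split 0 2 (split 3 0 (clash 1 9 3 0) (split 10 2 (clash 7 0 10 2) (done 9))) (done 22))
  (split 8 2 (split 11 1 (split 6 0 (clash 1 9 6 0) (split 10 2 (clash 7 8 10 2) (done 17))) (done 22))
  (done 7)))) (done 14))) (split 8 0 (split 10 2 (split 11 1 (split 4 1 (split 0 2 (clash 7 10 0 2) (split 9 0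
  (clash 1 8 9 0) (done 21))) (split 6 1 (split 0 2 (clash 7 10 0 2) (split 9 0 (clash 1 8 9 0) (done 21)))
  (done 7))) (done 15)) (done 10)) (done 12)))) (split 8 1 (split 9 0 (split 11 2 (split 5 1 (split 6 0
  (clash 1 9 6 0) (split 10 1 (clash 8 5 10 1) (done 15))) (split 7 1 (split 6 0 (clash 1 9 6 0) (split 10 1
  (clash 8 7 10 1) (done 15))) (done 7))) (done 12)) (done 13)) (split 9 1 (split 8 0 (split 10 2 (split 4 1
  (split 7 0 (clash 1 8 7 0) (split 11 1 (clash 9 4 11 1) (done 15))) (split 6 1 (split 7 0 (clash 1 8 7 0)
  (split 11 1 (clash 9 6 11 1) (done 15))) (done 7))) (done 11)) (done 13)) (done 6))))))))) (split 2 0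
  (split 3 1 (split 4 2 (split 5 1 (split 9 2 (split 8 1 (clash 3 5 8 1) (done 20)) (done 15)) (split 11 2
  (split 8 1 (split 10 0 (split 5 0 (clash 2 10 5 0) (split 9 2 (clash 4 11 9 2) (done 15))) (done 23))
  (done 21)) (done 16))) (split 5 2 (split 4 1 (split 8 2 (split 9 1 (clash 3 4 9 1) (done 20)) (done 15))
  (split 10 2 (split 9 1 (split 11 0 (split 4 0 (clash 2 11 4 0) (split 8 2 (clash 5 10 8 2) (done 15)))
  (done 23)) (done 22)) (done 16))) (split 8 1 (split 6 2 (split 1 1 (clash 3 8 1 1) (split 10 0 (split 1 2
  (split 0 2 (clash 6 1 0 2) (split 5 1 (clash 3 8 5 1) (done 16))) (split 5 0 (clash 2 10 5 0) (split 9 2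
  (split 5 1 (clash 3 8 5 1) (split 11 2 (clash 6 9 11 2) (done 16))) (done 15)))) (split 11 0 (split 0 2
  (split 1 2 (clash 6 0 1 2) (split 4 0 (clash 2 11 4 0) (done 15))) (split 5 1 (clash 3 8 5 1) (done 16)))
  (done 14)))) (split 7 2 (split 1 1 (clash 3 8 1 1) (split 10 0 (split 1 2 (split 0 2 (clash 7 1 0 2)
  (split 5 1 (clash 3 8 5 1) (done 16))) (split 5 0 (clash 2 10 5 0) (done 15))) (split 11 0 (split 1 2
  (split 0 2 (clash 7 1 0 2) (split 5 1 (clash 3 8 5 1) (done 16))) (split 4 0 (clash 2 11 4 0) (done 15)))
  (done 14)))) (done 8))) (split 9 1 (split 6 2 (split 1 1 (clash 3 9 1 1) (split 10 0 (split 1 2 (split 0 2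
  (clash 6 1 0 2) (split 4 1 (clash 3 9 4 1) (done 16))) (split 5 0 (clash 2 10 5 0) (done 15))) (split 11 0
  (split 1 2 (split 0 2 (clash 6 1 0 2) (split 4 1 (clash 3 9 4 1) (done 16))) (split 4 0 (clash 2 11 4 0)
  (done 15))) (done 14)))) (split 7 2 (split 1 1 (clash 3 9 1 1) (split 10 0 (split 0 2 (split 1 2
  (clash 7 0 1 2) (split 5 0 (clash 2 10 5 0) (done 15))) (split 4 1 (clash 3 9 4 1) (done 16))) (split 11 0
  (split 1 2 (split 0 2 (clash 7 1 0 2) (split 4 1 (clash 3 9 4 1) (done 16))) (split 4 0 (clash 2 11 4 0)
  (split 8 2 (split 4 1 (clash 3 9 4 1) (split 10 2 (clash 7 8 10 2) (done 16))) (done 15)))) (done 14))))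
  (done 8))) (done 5))))) (split 4 1 (split 3 2 (split 5 2 (split 8 2 (clash 3 5 8 2) (done 10)) (split 11 1
  (split 8 2 (split 10 0 (split 5 0 (clash 2 10 5 0) (split 9 1 (clash 4 11 9 1) (done 17))) (done 13))
  (done 11)) (done 8))) (split 5 2 (split 8 2 (split 10 0 (split 9 1 (split 11 0 (clash 2 10 11 0) (done 21))
  (done 17)) (done 12)) (split 10 2 (done 12) (done 10))) (split 9 1 (split 6 1 (clash 4 9 6 1) (split 10 0
  (split 6 2 (split 5 0 (clash 2 10 5 0) (split 11 2 (done 11) (done 10))) (split 7 2 (split 5 0
  (clash 2 10 5 0) (split 8 2 (split 1 2 (clash 7 8 1 2) (split 11 0 (clash 2 10 11 0) (done 21))) (done 10)))
  (split 11 1 (clash 4 9 11 1) (done 8)))) (split 11 0 (split 6 2 (done 10) (done 12)) (done 14))))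
  (split 11 1 (split 6 1 (clash 4 11 6 1) (split 10 0 (split 7 2 (split 5 0 (clash 2 10 5 0) (split 8 2
  (done 17) (done 10))) (split 8 2 (split 5 0 (clash 2 10 5 0) (done 17)) (done 11))) (done 14))) (done 5)))))
  (split 5 1 (split 3 2 (split 4 2 (split 9 2 (clash 3 4 9 2) (done 10)) (split 10 1 (split 9 2 (split 11 0
  (split 4 0 (clash 2 11 4 0) (split 8 1 (clash 5 10 8 1) (done 17))) (done 13)) (done 12)) (done 8)))
  (split 4 2 (split 9 2 (split 11 0 (split 8 1 (split 10 0 (clash 2 11 10 0) (done 22)) (done 17)) (done 11))
  (split 11 2 (done 11) (done 10))) (split 8 1 (split 7 1 (clash 5 8 7 1) (split 10 0 (split 6 2 (split 9 2
  (split 11 0 (clash 2 10 11 0) (done 11)) (split 11 2 (done 11) (done 10))) (split 7 2 (done 10) (done 8)))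
  (split 11 0 (split 6 2 (split 4 0 (clash 2 11 4 0) (split 9 2 (split 1 2 (clash 6 9 1 2) (done 22))
  (done 10))) (split 9 2 (split 10 1 (clash 5 8 10 1) (done 8)) (done 12))) (done 14)))) (split 10 1
  (split 7 1 (clash 5 10 7 1) (split 11 0 (split 6 2 (split 4 0 (clash 2 11 4 0) (split 9 2 (done 17)
  (done 10))) (split 9 2 (split 4 0 (clash 2 11 4 0) (done 17)) (done 12))) (done 14))) (done 5)))))
  (split 8 2 (split 1 2 (split 3 0 (split 0 1 (split 10 1 (split 4 0 (clash 2 3 4 0) (split 5 0
  (clash 2 3 5 0) (done 17))) (split 11 1 (split 4 0 (clash 2 3 4 0) (split 5 0 (clash 2 3 5 0) (done 17)))
  (done 5))) (split 7 2 (clash 8 1 7 2) (done 13))) (split 6 1 (split 3 2 (clash 8 1 3 2) (split 9 1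
  (split 7 2 (clash 8 1 7 2) (split 11 1 (clash 6 9 11 1) (done 8))) (split 11 1 (split 4 0 (split 0 1
  (clash 6 11 0 1) (split 7 2 (clash 8 1 7 2) (done 13))) (split 5 0 (split 0 1 (clash 6 11 0 1) (split 7 2
  (clash 8 1 7 2) (split 10 0 (clash 2 5 10 0) (done 13)))) (done 17))) (done 5)))) (split 7 1 (split 3 2
  (clash 8 1 3 2) (split 10 1 (split 0 1 (clash 7 10 0 1) (split 11 0 (split 9 2 (clash 8 1 9 2) (done 12))
  (done 13))) (done 5))) (done 16)))) (split 7 2 (split 3 0 (split 6 1 (split 4 0 (clash 2 3 4 0) (done 21))
  (done 23)) (split 6 1 (split 4 0 (split 5 2 (clash 8 7 5 2) (split 9 1 (split 1 1 (clash 6 9 1 1) (split 5 0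
  (clash 2 4 5 0) (done 12))) (split 11 1 (split 0 1 (clash 6 11 0 1) (split 5 0 (clash 2 4 5 0) (done 12)))
  (done 5)))) (split 11 0 (split 9 1 (split 1 1 (clash 6 9 1 1) (split 10 0 (clash 2 11 10 0) (done 12)))
  (done 20)) (done 21))) (split 10 2 (clash 8 7 10 2) (done 16)))) (split 10 0 (split 0 1 (split 3 2
  (split 6 1 (split 1 1 (clash 0 6 1 1) (split 5 0 (clash 2 10 5 0) (done 17))) (split 7 1 (split 1 1
  (clash 0 7 1 1) (split 5 0 (clash 2 10 5 0) (done 17))) (done 16))) (split 5 2 (split 1 1 (done 20)
  (done 17)) (split 11 1 (done 21) (done 5)))) (split 5 2 (split 6 1 (split 1 1 (split 3 2 (clash 8 5 3 2)
  (split 9 1 (clash 6 1 9 1) (done 20))) (split 9 1 (split 3 2 (clash 8 5 3 2) (split 11 0 (clash 2 10 11 0)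
  (done 21))) (done 17))) (split 7 1 (split 1 1 (split 3 2 (clash 8 5 3 2) (done 20)) (done 17)) (done 16)))
  (split 11 1 (split 6 1 (split 3 2 (split 5 0 (clash 2 10 5 0) (split 9 1 (clash 11 6 9 1) (done 17)))
  (done 21)) (done 16)) (done 8)))) (split 11 0 (split 0 1 (split 3 2 (split 6 1 (split 1 1 (clash 0 6 1 1)
  (split 4 0 (clash 2 11 4 0) (done 17))) (split 7 1 (split 1 1 (clash 0 7 1 1) (split 4 0 (clash 2 11 4 0)
  (done 17))) (done 16))) (split 6 1 (split 5 2 (split 4 0 (clash 2 11 4 0) (done 20)) (done 5)) (done 22)))
  (split 5 2 (split 1 1 (split 6 1 (split 3 2 (clash 8 5 3 2) (split 4 0 (clash 2 11 4 0) (split 9 1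
  (clash 1 6 9 1) (done 20)))) (split 7 1 (split 3 2 (clash 8 5 3 2) (done 22)) (split 10 2 (clash 8 5 10 2)
  (done 16)))) (done 12)) (split 10 1 (split 9 2 (split 7 1 (split 4 0 (clash 2 11 4 0) (done 17)) (done 16))
  (done 12)) (done 8)))) (done 19))))) (split 9 2 (split 1 2 (split 0 1 (split 4 0 (split 3 2 (clash 9 1 3 2)
  (split 10 1 (split 3 0 (clash 2 4 3 0) (split 7 1 (clash 0 10 7 1) (done 16))) (split 11 1 (split 3 0
  (clash 2 4 3 0) (split 6 1 (clash 0 11 6 1) (done 16))) (done 5)))) (split 5 0 (split 3 2 (clash 9 1 3 2)
  (split 10 1 (split 3 0 (clash 2 5 3 0) (split 7 1 (clash 0 10 7 1) (done 16))) (split 11 1 (split 3 0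
  (clash 2 5 3 0) (split 6 1 (clash 0 11 6 1) (done 16))) (done 5)))) (done 17))) (split 4 0 (split 6 2
  (clash 9 1 6 2) (split 11 0 (clash 2 4 11 0) (done 13))) (split 11 0 (split 8 1 (split 7 1 (split 6 2
  (clash 9 1 6 2) (split 10 1 (clash 8 7 10 1) (done 8))) (done 16)) (done 17)) (done 11)))) (split 6 2
  (split 3 0 (split 7 1 (split 5 0 (clash 2 3 5 0) (done 22)) (done 23)) (split 7 1 (split 5 0 (split 4 2
  (clash 9 6 4 2) (split 8 1 (split 1 1 (clash 7 8 1 1) (split 4 0 (clash 2 5 4 0) (done 11))) (split 10 1
  (split 0 1 (clash 7 10 0 1) (split 4 0 (clash 2 5 4 0) (done 11))) (done 5)))) (split 10 0 (split 8 1
  (split 1 1 (clash 7 8 1 1) (split 11 0 (clash 2 10 11 0) (done 11))) (done 20)) (done 22))) (split 11 2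
  (clash 9 6 11 2) (done 16)))) (split 10 0 (split 0 1 (split 3 2 (split 6 1 (split 1 1 (clash 0 6 1 1)
  (split 5 0 (clash 2 10 5 0) (done 17))) (split 7 1 (split 1 1 (clash 0 7 1 1) (split 5 0 (clash 2 10 5 0)
  (done 17))) (done 16))) (split 4 2 (split 5 0 (clash 2 10 5 0) (split 11 1 (done 17) (done 20))) (split 11 1
  (done 21) (done 5)))) (split 4 2 (split 1 1 (split 6 1 (split 3 2 (clash 9 4 3 2) (split 5 0
  (clash 2 10 5 0) (done 20))) (split 7 1 (split 3 2 (clash 9 4 3 2) (split 5 0 (clash 2 10 5 0) (split 8 1
  (clash 1 7 8 1) (done 20)))) (split 11 2 (clash 9 4 11 2) (done 16)))) (split 11 0 (clash 2 10 11 0)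
  (done 11))) (split 11 1 (done 11) (done 8)))) (split 11 0 (split 3 2 (split 6 1 (split 0 1 (split 1 1
  (clash 6 0 1 1) (split 4 0 (clash 2 11 4 0) (done 17))) (split 4 2 (clash 9 3 4 2) (done 8))) (split 7 1
  (split 0 1 (split 1 1 (clash 7 0 1 1) (split 4 0 (clash 2 11 4 0) (done 17))) (split 4 2 (clash 9 3 4 2)
  (split 10 1 (split 4 0 (clash 2 11 4 0) (split 8 1 (clash 7 10 8 1) (done 17))) (done 8)))) (done 16)))
  (split 6 1 (split 4 2 (done 20) (done 5)) (done 22))) (done 19))))) (split 10 2 (split 0 2 (split 8 1
  (split 3 0 (split 1 1 (split 4 0 (clash 2 3 4 0) (split 5 0 (clash 2 3 5 0) (done 15))) (split 7 2
  (clash 10 0 7 2) (done 13))) (split 7 2 (clash 10 0 7 2) (split 11 1 (done 13) (done 8)))) (split 9 1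
  (split 3 0 (split 1 1 (split 4 0 (clash 2 3 4 0) (split 5 0 (clash 2 3 5 0) (done 15))) (split 7 2
  (clash 10 0 7 2) (done 13))) (split 7 2 (clash 10 0 7 2) (split 11 1 (done 13) (done 8)))) (split 11 1
  (split 5 0 (split 7 2 (clash 10 0 7 2) (done 13)) (done 12)) (done 5)))) (split 7 2 (split 6 1 (split 4 0
  (split 5 2 (clash 10 7 5 2) (split 9 1 (split 1 1 (clash 6 9 1 1) (split 5 0 (clash 2 4 5 0) (done 12)))
  (split 11 1 (split 0 1 (clash 6 11 0 1) (split 5 0 (clash 2 4 5 0) (done 12))) (done 5)))) (split 11 0
  (split 0 1 (done 20) (done 15)) (done 21))) (split 11 0 (split 9 1 (split 1 1 (split 4 0 (clash 2 11 4 0)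
  (done 15)) (done 12)) (done 22)) (done 23))) (split 11 0 (split 0 1 (split 5 2 (split 4 0 (clash 2 11 4 0)
  (done 20)) (done 5)) (split 5 2 (split 1 1 (split 4 0 (clash 2 11 4 0) (done 15)) (done 12)) (done 8)))
  (done 19)))) (split 11 2 (split 0 1 (split 4 2 (split 6 2 (clash 11 4 6 2) (split 10 0 (split 5 0
  (clash 2 10 5 0) (done 20)) (done 19))) (split 10 1 (split 6 2 (split 5 0 (split 7 1 (clash 0 10 7 1)
  (done 23)) (done 22)) (done 19)) (done 5))) (split 1 1 (split 4 0 (split 8 1 (split 3 0 (clash 2 4 3 0)
  (split 6 2 (split 0 2 (clash 11 6 0 2) (split 7 1 (clash 1 8 7 1) (done 23))) (done 8))) (split 9 1
  (split 3 0 (clash 2 4 3 0) (split 6 2 (split 0 2 (clash 11 6 0 2) (done 23)) (done 8))) (done 5)))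
  (split 5 0 (split 4 2 (split 6 2 (clash 11 4 6 2) (split 10 0 (clash 2 5 10 0) (done 19))) (split 8 1
  (split 3 0 (clash 2 5 3 0) (split 6 2 (split 0 2 (clash 11 6 0 2) (split 7 1 (clash 1 8 7 1) (split 10 0
  (clash 2 5 10 0) (done 23)))) (done 8))) (split 9 1 (split 0 2 (split 3 0 (clash 2 5 3 0) (split 6 2
  (clash 11 0 6 2) (done 8))) (done 21)) (done 5)))) (done 15))) (split 4 0 (split 6 2 (split 7 1 (split 8 1
  (split 0 2 (clash 11 6 0 2) (split 5 0 (clash 2 4 5 0) (done 22))) (split 10 1 (split 0 2 (clash 11 6 0 2)
  (split 5 0 (clash 2 4 5 0) (done 22))) (done 5))) (done 14)) (done 13)) (done 11)))) (done 4))))))))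
  (split 3 0 (split 2 1 (split 4 2 (split 5 1 (split 11 2 (split 10 1 (clash 2 5 10 1) (done 20)) (done 17))
  (split 9 2 (split 10 1 (split 8 0 (split 5 0 (clash 3 8 5 0) (split 11 2 (clash 4 9 11 2) (done 17)))
  (done 23)) (done 21)) (done 7))) (split 5 2 (split 4 1 (split 10 2 (split 11 1 (clash 2 4 11 1) (done 20))
  (done 17)) (split 8 2 (split 11 1 (split 9 0 (split 4 0 (clash 3 9 4 0) (split 10 2 (clash 5 8 10 2)
  (done 17))) (done 23)) (done 22)) (done 7))) (split 10 1 (split 6 2 (split 1 2 (split 0 1 (clash 2 10 0 1)
  (split 8 0 (split 0 2 (clash 6 1 0 2) (split 5 0 (clash 3 8 5 0) (done 17))) (split 9 0 (split 0 2
  (clash 6 1 0 2) (split 4 0 (clash 3 9 4 0) (done 17))) (done 14)))) (split 5 1 (clash 2 10 5 1) (split 9 2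
  (split 8 0 (split 5 0 (clash 3 8 5 0) (split 11 2 (clash 6 9 11 2) (done 17))) (done 23)) (done 7))))
  (split 7 2 (split 1 2 (split 0 1 (clash 2 10 0 1) (split 8 0 (split 0 2 (clash 7 1 0 2) (split 5 0
  (clash 3 8 5 0) (done 17))) (split 9 0 (split 0 2 (clash 7 1 0 2) (split 4 0 (clash 3 9 4 0) (done 17)))
  (done 14)))) (split 5 1 (clash 2 10 5 1) (split 8 2 (split 9 0 (split 4 0 (clash 3 9 4 0) (done 17))
  (done 23)) (done 7)))) (done 6))) (split 11 1 (split 6 2 (split 1 2 (split 0 1 (clash 2 11 0 1) (split 8 0
  (split 0 2 (clash 6 1 0 2) (split 5 0 (clash 3 8 5 0) (done 17))) (split 9 0 (split 0 2 (clash 6 1 0 2)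
  (split 4 0 (clash 3 9 4 0) (done 17))) (done 14)))) (split 4 1 (clash 2 11 4 1) (split 9 2 (split 4 0
  (done 23) (done 21)) (done 7)))) (split 7 2 (split 1 2 (split 0 1 (clash 2 11 0 1) (split 8 0 (split 0 2
  (clash 7 1 0 2) (split 5 0 (clash 3 8 5 0) (done 17))) (split 9 0 (split 0 2 (clash 7 1 0 2) (split 4 0
  (clash 3 9 4 0) (done 17))) (done 14)))) (split 4 1 (clash 2 11 4 1) (split 8 2 (split 9 0 (split 4 0
  (clash 3 9 4 0) (split 10 2 (clash 7 8 10 2) (done 17))) (done 23)) (done 7)))) (done 6))) (done 5)))))
  (split 4 1 (split 2 2 (split 5 2 (split 10 2 (clash 2 5 10 2) (done 10)) (split 9 1 (split 10 2 (split 8 0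
  (split 5 0 (clash 3 8 5 0) (split 11 1 (clash 4 9 11 1) (done 15))) (done 13)) (done 11)) (done 6)))
  (split 5 2 (split 8 2 (done 12) (split 10 2 (split 8 0 (split 11 1 (split 9 0 (clash 3 8 9 0) (done 21))
  (done 15)) (done 12)) (done 10))) (split 9 1 (split 6 1 (clash 4 9 6 1) (split 8 0 (split 7 2 (split 5 0
  (clash 3 8 5 0) (split 10 2 (split 11 1 (clash 4 9 11 1) (done 15)) (done 10))) (split 10 2 (split 0 2
  (split 5 0 (clash 3 8 5 0) (split 11 1 (clash 4 9 11 1) (done 15))) (done 21)) (done 11))) (done 14)))
  (split 11 1 (split 6 2 (split 5 0 (split 7 2 (split 8 0 (clash 3 5 8 0) (done 14)) (done 11)) (split 9 2
  (done 11) (done 10))) (split 7 2 (split 5 0 (split 6 1 (clash 4 11 6 1) (split 8 0 (clash 3 5 8 0)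
  (done 14))) (split 8 0 (split 10 2 (split 0 2 (clash 7 10 0 2) (split 9 0 (clash 3 8 9 0) (done 21)))
  (done 10)) (done 12))) (done 6))) (done 5))))) (split 5 1 (split 2 2 (split 4 2 (split 11 2 (clash 2 4 11 2)
  (done 10)) (split 8 1 (split 11 2 (split 9 0 (split 4 0 (clash 3 9 4 0) (split 10 1 (clash 5 8 10 1)
  (done 15))) (done 13)) (done 12)) (done 6))) (split 4 2 (split 9 2 (done 11) (split 11 2 (split 9 0
  (split 10 1 (split 8 0 (clash 3 9 8 0) (done 22)) (done 15)) (done 11)) (done 10))) (split 8 1 (split 7 1
  (clash 5 8 7 1) (split 9 0 (split 6 2 (split 4 0 (clash 3 9 4 0) (split 11 2 (split 10 1 (clash 5 8 10 1)
  (done 15)) (done 10))) (split 11 2 (split 0 2 (split 4 0 (clash 3 9 4 0) (split 10 1 (clash 5 8 10 1)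
  (done 15))) (done 22)) (done 12))) (done 14))) (split 10 1 (split 6 2 (split 4 0 (split 7 1 (clash 5 10 7 1)
  (split 9 0 (clash 3 4 9 0) (done 14))) (split 9 2 (done 11) (split 11 2 (split 9 0 (split 0 2
  (clash 6 11 0 2) (split 8 0 (clash 3 9 8 0) (done 22))) (done 11)) (done 10)))) (split 7 2 (split 8 0
  (done 10) (done 12)) (done 6))) (done 5))))) (split 8 2 (split 1 2 (split 7 2 (clash 8 1 7 2) (split 9 1
  (done 13) (done 6))) (split 7 2 (split 6 1 (split 4 0 (split 5 2 (clash 8 7 5 2) (split 9 1 (split 1 1
  (clash 6 9 1 1) (split 5 0 (clash 3 4 5 0) (done 12))) (split 11 1 (split 0 1 (clash 6 11 0 1) (split 5 0
  (clash 3 4 5 0) (done 12))) (done 5)))) (split 9 0 (split 11 1 (split 0 1 (clash 6 11 0 1) (done 12))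
  (done 20)) (done 21))) (split 9 0 (split 11 1 (split 0 1 (split 4 0 (clash 3 9 4 0) (split 10 2
  (clash 8 7 10 2) (done 17))) (done 12)) (done 22)) (done 23))) (split 9 0 (split 1 1 (split 5 2 (split 4 0
  (clash 3 9 4 0) (done 20)) (done 5)) (split 5 2 (split 0 1 (split 4 0 (clash 3 9 4 0) (split 10 2
  (clash 8 5 10 2) (done 17))) (done 12)) (done 6))) (done 19)))) (split 9 2 (split 1 2 (split 6 2
  (clash 9 1 6 2) (split 8 1 (done 13) (done 6))) (split 6 2 (split 7 1 (split 5 0 (split 4 2 (clash 9 6 4 2)
  (split 8 1 (split 1 1 (clash 7 8 1 1) (split 4 0 (clash 3 5 4 0) (done 11))) (split 10 1 (split 0 1
  (clash 7 10 0 1) (split 4 0 (clash 3 5 4 0) (done 11))) (done 5)))) (split 8 0 (split 10 1 (split 0 1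
  (clash 7 10 0 1) (done 11)) (done 20)) (done 22))) (split 8 0 (split 10 1 (split 0 1 (split 5 0
  (clash 3 8 5 0) (split 11 2 (clash 9 6 11 2) (done 17))) (done 11)) (done 21)) (done 23))) (split 8 0
  (split 1 1 (split 4 2 (split 5 0 (clash 3 8 5 0) (done 20)) (done 5)) (split 4 2 (split 0 1 (split 5 0
  (clash 3 8 5 0) (split 11 2 (clash 9 4 11 2) (done 17))) (done 11)) (done 6))) (done 19)))) (split 10 2
  (split 6 1 (split 2 2 (split 1 1 (split 0 1 (clash 6 1 0 1) (split 4 0 (split 0 2 (clash 10 2 0 2)
  (split 9 0 (clash 3 4 9 0) (done 19))) (split 5 0 (split 0 2 (clash 10 2 0 2) (split 8 0 (clash 3 5 8 0)
  (done 19))) (done 15)))) (split 5 2 (clash 10 2 5 2) (split 9 1 (split 8 0 (split 5 0 (clash 3 8 5 0)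
  (split 11 1 (clash 6 9 11 1) (done 15))) (done 13)) (done 6)))) (split 5 2 (split 0 1 (split 4 0 (split 7 2
  (clash 10 5 7 2) (split 9 0 (clash 3 4 9 0) (done 19))) (split 11 1 (clash 6 0 11 1) (done 20))) (split 1 1
  (split 4 0 (split 7 2 (clash 10 5 7 2) (split 9 0 (clash 3 4 9 0) (done 19))) (done 15)) (split 8 0
  (split 11 1 (split 9 0 (clash 3 8 9 0) (done 21)) (done 15)) (done 12)))) (split 9 1 (split 0 2 (split 1 1
  (clash 6 9 1 1) (split 7 2 (clash 10 0 7 2) (split 8 0 (split 5 0 (clash 3 8 5 0) (split 11 1
  (clash 6 9 11 1) (done 15))) (done 13)))) (split 4 0 (split 7 2 (split 1 1 (clash 6 9 1 1) (split 5 0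
  (clash 3 4 5 0) (done 12))) (done 19)) (done 21))) (split 11 1 (split 7 2 (split 0 1 (clash 6 11 0 1)
  (split 5 0 (split 0 2 (clash 10 7 0 2) (split 4 0 (clash 3 5 4 0) (done 21))) (split 8 0 (split 0 2
  (clash 10 7 0 2) (split 9 0 (clash 3 8 9 0) (done 21))) (done 12)))) (done 6)) (done 5))))) (split 7 1
  (split 2 2 (split 1 1 (split 0 1 (clash 7 1 0 1) (split 4 0 (split 0 2 (clash 10 2 0 2) (split 9 0
  (clash 3 4 9 0) (done 19))) (split 5 0 (split 0 2 (clash 10 2 0 2) (split 8 0 (clash 3 5 8 0) (done 19)))
  (done 15)))) (split 5 2 (clash 10 2 5 2) (split 8 1 (split 9 0 (split 11 2 (clash 10 2 11 2) (done 12))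
  (done 13)) (done 6)))) (split 5 2 (split 8 0 (done 20) (done 22)) (split 8 1 (split 1 1 (clash 7 8 1 1)
  (split 9 0 (split 11 2 (split 4 0 (clash 3 9 4 0) (done 15)) (done 12)) (done 13))) (done 5)))) (done 7)))
  (split 11 2 (split 6 1 (split 2 2 (split 1 1 (split 0 1 (clash 6 1 0 1) (split 4 0 (split 0 2
  (clash 11 2 0 2) (split 9 0 (clash 3 4 9 0) (done 19))) (split 5 0 (split 0 2 (clash 11 2 0 2) (split 8 0
  (clash 3 5 8 0) (done 19))) (done 15)))) (split 4 2 (clash 11 2 4 2) (split 9 1 (split 4 0 (done 13)
  (done 11)) (done 6)))) (split 4 2 (split 0 1 (split 5 0 (split 8 0 (clash 3 5 8 0) (done 19)) (done 20))
  (split 5 0 (split 1 1 (split 8 0 (clash 3 5 8 0) (done 19)) (done 11)) (done 15))) (split 9 1 (split 1 1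
  (clash 6 9 1 1) (split 4 0 (done 13) (done 11))) (done 5)))) (split 7 1 (split 2 2 (split 1 1 (split 0 1
  (clash 7 1 0 1) (split 4 0 (split 0 2 (clash 11 2 0 2) (split 9 0 (clash 3 4 9 0) (done 19))) (split 5 0
  (split 0 2 (clash 11 2 0 2) (split 8 0 (clash 3 5 8 0) (done 19))) (done 15)))) (split 4 2 (clash 11 2 4 2)
  (split 8 1 (split 9 0 (split 4 0 (clash 3 9 4 0) (split 10 1 (clash 7 8 10 1) (done 15))) (done 13))
  (done 6)))) (split 4 2 (split 5 0 (split 0 1 (split 6 2 (clash 11 4 6 2) (split 8 0 (clash 3 5 8 0)
  (done 19))) (split 1 1 (split 6 2 (clash 11 4 6 2) (split 8 0 (clash 3 5 8 0) (done 19))) (done 11)))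
  (split 8 0 (split 10 1 (split 0 1 (clash 7 10 0 1) (split 9 0 (clash 3 8 9 0) (done 11))) (done 20))
  (done 22))) (split 8 1 (split 0 2 (split 1 1 (clash 7 8 1 1) (split 4 0 (split 6 2 (clash 11 0 6 2)
  (split 9 0 (clash 3 4 9 0) (done 13))) (split 9 0 (split 10 1 (clash 7 8 10 1) (done 15)) (done 11))))
  (split 5 0 (split 6 2 (split 1 1 (clash 7 8 1 1) (split 4 0 (clash 3 5 4 0) (done 11))) (done 19))
  (done 22))) (split 10 1 (split 6 2 (split 0 1 (clash 7 10 0 1) (split 4 0 (split 0 2 (clash 11 6 0 2)
  (split 5 0 (clash 3 4 5 0) (done 22))) (split 9 0 (split 0 2 (clash 11 6 0 2) (split 8 0 (clash 3 9 8 0)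
  (done 22))) (done 11)))) (done 6)) (done 5))))) (done 7))) (done 4)))))))) (split 4 1 (split 5 1 (split 6 2
  (split 7 0 (split 9 2 (split 2 1 (clash 4 5 2 1) (split 3 1 (clash 4 5 3 1) (done 11))) (split 11 2
  (split 2 1 (clash 4 5 2 1) (split 3 1 (clash 4 5 3 1) (done 11))) (done 9))) (done 5)) (split 7 2 (split 6 0
  (split 8 2 (split 2 1 (clash 4 5 2 1) (split 3 1 (clash 4 5 3 1) (done 12))) (split 10 2 (split 2 1
  (clash 4 5 2 1) (split 3 1 (clash 4 5 3 1) (done 12))) (done 9))) (done 5)) (done 3))) (split 6 2 (split 5 2
  (split 7 1 (done 10) (done 9)) (split 7 0 (split 2 1 (split 8 0 (split 0 2 (split 5 0 (clash 7 8 5 0)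
  (split 11 2 (clash 6 0 11 2) (done 9))) (split 1 2 (split 5 0 (clash 7 8 5 0) (split 9 2 (clash 6 1 9 2)
  (done 9))) (done 21))) (split 10 0 (split 0 2 (split 5 0 (clash 7 10 5 0) (split 11 2 (clash 6 0 11 2)
  (done 9))) (split 1 2 (split 5 0 (clash 7 10 5 0) (split 9 2 (clash 6 1 9 2) (done 9))) (done 21)))
  (done 14))) (split 3 1 (split 8 0 (split 0 2 (split 5 0 (clash 7 8 5 0) (split 11 2 (clash 6 0 11 2)
  (done 9))) (split 1 2 (split 5 0 (clash 7 8 5 0) (split 9 2 (clash 6 1 9 2) (done 9))) (done 21)))
  (split 10 0 (split 0 2 (split 5 0 (clash 7 10 5 0) (split 11 2 (clash 6 0 11 2) (done 9))) (split 1 2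
  (split 5 0 (clash 7 10 5 0) (split 9 2 (clash 6 1 9 2) (done 9))) (done 21))) (done 14))) (done 11)))
  (split 9 1 (split 5 0 (split 3 1 (clash 4 9 3 1) (split 7 2 (split 8 0 (split 0 2 (clash 6 7 0 2) (split 1 2
  (clash 6 7 1 2) (done 21))) (split 10 0 (split 0 2 (clash 6 7 0 2) (split 1 2 (clash 6 7 1 2) (done 21)))
  (done 14))) (done 11))) (split 11 2 (done 15) (done 9))) (split 11 1 (split 5 0 (split 2 1 (clash 4 11 2 1)
  (split 7 2 (split 8 0 (split 0 2 (clash 6 7 0 2) (split 1 2 (clash 6 7 1 2) (done 21))) (split 10 0
  (split 0 2 (clash 6 7 0 2) (split 1 2 (clash 6 7 1 2) (done 21))) (done 14))) (done 11))) (split 9 2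
  (done 17) (done 9))) (done 5))))) (split 7 1 (split 5 2 (done 18) (done 3)) (split 9 2 (split 11 1
  (split 10 0 (split 2 1 (clash 4 11 2 1) (split 8 2 (split 5 0 (split 1 2 (clash 9 8 1 2) (split 3 2
  (clash 9 8 3 2) (done 21))) (split 7 0 (split 1 2 (clash 9 8 1 2) (split 3 2 (clash 9 8 3 2) (done 21)))
  (done 17))) (done 11))) (done 6)) (done 3)) (split 11 2 (split 9 1 (split 8 0 (split 3 1 (clash 4 9 3 1)
  (split 10 2 (split 5 0 (split 0 2 (clash 11 10 0 2) (split 2 2 (clash 11 10 2 2) (done 21))) (split 7 0
  (split 0 2 (clash 11 10 0 2) (split 2 2 (clash 11 10 2 2) (done 21))) (done 15))) (done 11))) (done 8))
  (done 3)) (done 2)))))) (split 5 1 (split 6 1 (split 4 2 (split 7 2 (done 10) (done 18)) (split 7 2 (done 5)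
  (done 3))) (split 7 2 (split 4 0 (split 9 0 (split 0 2 (split 6 0 (clash 4 9 6 0) (split 8 1 (split 3 1
  (clash 5 8 3 1) (split 6 2 (clash 7 0 6 2) (done 12))) (split 10 1 (split 2 1 (clash 5 10 2 1) (split 6 2
  (clash 7 0 6 2) (done 12))) (done 5)))) (split 1 2 (split 6 0 (clash 4 9 6 0) (split 8 1 (split 3 1
  (clash 5 8 3 1) (split 6 2 (clash 7 1 6 2) (done 12))) (split 10 1 (split 2 1 (clash 5 10 2 1) (split 6 2
  (clash 7 1 6 2) (done 12))) (done 5)))) (done 22))) (split 11 0 (split 0 2 (split 6 0 (clash 4 11 6 0)
  (split 8 1 (split 3 1 (clash 5 8 3 1) (split 6 2 (clash 7 0 6 2) (done 12))) (split 10 1 (split 2 1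
  (clash 5 10 2 1) (split 6 2 (clash 7 0 6 2) (done 12))) (done 5)))) (split 1 2 (split 6 0 (clash 4 11 6 0)
  (split 8 1 (split 3 1 (clash 5 8 3 1) (split 6 2 (clash 7 1 6 2) (done 12))) (split 10 1 (split 2 1
  (clash 5 10 2 1) (split 6 2 (clash 7 1 6 2) (done 12))) (done 5)))) (done 22))) (done 14))) (split 8 2
  (split 6 0 (split 1 2 (clash 7 8 1 2) (done 22)) (split 10 1 (done 17) (done 5))) (split 10 2 (split 6 0
  (split 0 2 (clash 7 10 0 2) (done 22)) (split 8 1 (done 15) (done 5))) (done 9)))) (split 8 2 (split 10 1
  (split 11 0 (split 2 1 (clash 5 10 2 1) (split 9 2 (split 4 0 (split 1 2 (clash 8 9 1 2) (split 3 2
  (clash 8 9 3 2) (done 22))) (split 6 0 (split 1 2 (clash 8 9 1 2) (split 3 2 (clash 8 9 3 2) (done 22)))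
  (done 17))) (done 12))) (done 6)) (done 3)) (split 10 2 (split 8 1 (split 9 0 (split 3 1 (clash 5 8 3 1)
  (split 11 2 (split 4 0 (split 0 2 (clash 10 11 0 2) (split 2 2 (clash 10 11 2 2) (done 22))) (split 6 0
  (split 0 2 (clash 10 11 0 2) (split 2 2 (clash 10 11 2 2) (done 22))) (done 15))) (done 12))) (done 8))
  (done 3)) (done 1))))) (split 6 1 (split 4 2 (split 7 0 (split 8 0 (split 2 2 (split 0 1 (split 5 0
  (clash 7 8 5 0) (split 11 1 (clash 6 0 11 1) (done 18))) (split 1 1 (split 5 0 (clash 7 8 5 0) (split 9 1
  (clash 6 1 9 1) (done 18))) (split 5 2 (clash 4 2 5 2) (done 11)))) (split 3 2 (split 0 1 (split 5 0
  (clash 7 8 5 0) (split 11 1 (clash 6 0 11 1) (done 18))) (split 1 1 (split 5 0 (clash 7 8 5 0) (split 9 1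
  (clash 6 1 9 1) (done 18))) (split 5 2 (clash 4 3 5 2) (done 11)))) (done 21))) (split 10 0 (split 2 2
  (split 0 1 (split 5 0 (clash 7 10 5 0) (split 11 1 (clash 6 0 11 1) (done 18))) (split 1 1 (split 5 0
  (clash 7 10 5 0) (split 9 1 (clash 6 1 9 1) (done 18))) (split 5 2 (clash 4 2 5 2) (done 11)))) (split 3 2
  (split 0 1 (split 5 0 (clash 7 10 5 0) (split 11 1 (clash 6 0 11 1) (done 18))) (split 1 1 (split 5 0
  (clash 7 10 5 0) (split 9 1 (clash 6 1 9 1) (done 18))) (split 5 2 (clash 4 3 5 2) (done 11)))) (done 21)))
  (done 19))) (split 9 2 (split 5 0 (split 0 1 (split 8 0 (split 3 2 (clash 4 9 3 2) (split 7 1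
  (clash 6 0 7 1) (done 21))) (split 10 0 (split 3 2 (clash 4 9 3 2) (split 7 1 (clash 6 0 7 1) (done 21)))
  (done 19))) (split 1 1 (split 8 0 (split 3 2 (clash 4 9 3 2) (split 7 1 (clash 6 1 7 1) (done 21)))
  (split 10 0 (split 3 2 (clash 4 9 3 2) (split 7 1 (clash 6 1 7 1) (done 21))) (done 19))) (done 11)))
  (split 11 1 (done 17) (done 18))) (split 11 2 (split 0 1 (split 5 0 (split 8 0 (split 2 2 (clash 4 11 2 2)
  (split 7 1 (clash 6 0 7 1) (done 21))) (split 10 0 (split 2 2 (clash 4 11 2 2) (split 7 1 (clash 6 0 7 1)
  (done 21))) (done 19))) (done 18)) (split 5 0 (split 1 1 (split 8 0 (split 2 2 (clash 4 11 2 2) (split 7 1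
  (clash 6 1 7 1) (done 21))) (split 10 0 (split 2 2 (clash 4 11 2 2) (split 7 1 (clash 6 1 7 1) (done 21)))
  (done 19))) (done 11)) (done 15))) (done 4)))) (split 7 1 (split 5 2 (split 4 0 (split 8 2 (split 0 1
  (clash 6 7 0 1) (split 1 1 (clash 6 7 1 1) (done 12))) (split 10 2 (split 0 1 (clash 6 7 0 1) (split 1 1
  (clash 6 7 1 1) (done 12))) (done 4))) (done 18)) (done 3)) (split 9 2 (split 11 1 (split 10 0 (split 0 1
  (clash 6 11 0 1) (split 8 2 (split 5 0 (split 1 2 (clash 9 8 1 2) (split 3 2 (clash 9 8 3 2) (done 21)))
  (split 7 0 (split 1 2 (clash 9 8 1 2) (split 3 2 (clash 9 8 3 2) (done 21))) (done 17))) (done 11)))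
  (done 6)) (done 3)) (split 11 2 (split 9 1 (split 8 0 (split 1 1 (clash 6 9 1 1) (split 10 2 (split 5 0
  (split 0 2 (clash 11 10 0 2) (split 2 2 (clash 11 10 2 2) (done 21))) (split 7 0 (split 0 2
  (clash 11 10 0 2) (split 2 2 (clash 11 10 2 2) (done 21))) (done 15))) (done 11))) (done 8)) (done 3))
  (done 2))))) (split 7 1 (split 5 2 (split 6 0 (split 9 0 (split 2 2 (split 0 1 (split 4 0 (clash 6 9 4 0)
  (split 10 1 (clash 7 0 10 1) (done 18))) (split 1 1 (split 4 0 (clash 6 9 4 0) (split 8 1 (clash 7 1 8 1)
  (done 18))) (split 4 2 (clash 5 2 4 2) (done 12)))) (split 3 2 (split 0 1 (split 4 0 (clash 6 9 4 0)
  (split 10 1 (clash 7 0 10 1) (done 18))) (split 1 1 (split 4 0 (clash 6 9 4 0) (split 8 1 (clash 7 1 8 1)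
  (done 18))) (split 4 2 (clash 5 3 4 2) (done 12)))) (done 22))) (split 11 0 (split 2 2 (split 0 1 (split 4 0
  (clash 6 11 4 0) (split 10 1 (clash 7 0 10 1) (done 18))) (split 1 1 (split 4 0 (clash 6 11 4 0) (split 8 1
  (clash 7 1 8 1) (done 18))) (split 4 2 (clash 5 2 4 2) (done 12)))) (split 3 2 (split 0 1 (split 4 0
  (clash 6 11 4 0) (split 10 1 (clash 7 0 10 1) (done 18))) (split 1 1 (split 4 0 (clash 6 11 4 0) (split 8 1
  (clash 7 1 8 1) (done 18))) (split 4 2 (clash 5 3 4 2) (done 12)))) (done 22))) (done 19))) (split 8 2
  (split 4 0 (split 3 2 (clash 5 8 3 2) (done 22)) (split 10 1 (done 17) (done 18))) (split 10 2 (split 0 1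
  (split 4 0 (split 2 2 (clash 5 10 2 2) (done 22)) (done 18)) (split 4 0 (split 1 1 (split 2 2
  (clash 5 10 2 2) (done 22)) (done 12)) (done 15))) (done 4)))) (split 8 2 (split 10 1 (split 11 0 (split 0 1
  (clash 7 10 0 1) (split 9 2 (split 4 0 (split 1 2 (clash 8 9 1 2) (split 3 2 (clash 8 9 3 2) (done 22)))
  (split 6 0 (split 1 2 (clash 8 9 1 2) (split 3 2 (clash 8 9 3 2) (done 22))) (done 17))) (done 12)))
  (done 6)) (done 3)) (split 10 2 (split 8 1 (split 9 0 (split 1 1 (clash 7 8 1 1) (split 11 2 (split 4 0
  (split 0 2 (clash 10 11 0 2) (split 2 2 (clash 10 11 2 2) (done 22))) (split 6 0 (split 0 2
  (clash 10 11 0 2) (split 2 2 (clash 10 11 2 2) (done 22))) (done 15))) (done 12))) (done 8)) (done 3))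
  (done 1)))) (split 8 2 (split 9 2 (split 10 1 (split 11 0 (done 16) (done 6)) (split 11 1 (split 10 0
  (done 16) (done 6)) (done 3))) (split 10 1 (split 9 0 (split 5 2 (split 0 1 (split 4 0 (split 3 2
  (clash 8 5 3 2) (split 11 1 (clash 10 0 11 1) (done 22))) (split 6 0 (split 3 2 (clash 8 5 3 2) (split 11 1
  (clash 10 0 11 1) (done 22))) (done 17))) (split 2 1 (split 4 0 (split 3 2 (clash 8 5 3 2) (split 11 1
  (clash 10 2 11 1) (done 22))) (split 6 0 (split 3 2 (clash 8 5 3 2) (split 11 1 (clash 10 2 11 1)
  (done 22))) (done 17))) (done 12))) (split 7 2 (split 0 1 (split 4 0 (split 1 2 (clash 8 7 1 2) (split 11 1
  (clash 10 0 11 1) (done 22))) (split 6 0 (split 1 2 (clash 8 7 1 2) (split 11 1 (clash 10 0 11 1)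
  (done 22))) (done 17))) (split 2 1 (split 4 0 (split 1 2 (clash 8 7 1 2) (split 11 1 (clash 10 2 11 1)
  (done 22))) (split 6 0 (split 1 2 (clash 8 7 1 2) (split 11 1 (clash 10 2 11 1) (done 22))) (done 17)))
  (done 12))) (split 11 0 (split 0 1 (split 4 0 (clash 9 11 4 0) (split 6 0 (clash 9 11 6 0) (done 17)))
  (split 2 1 (split 4 0 (clash 9 11 4 0) (split 6 0 (clash 9 11 6 0) (done 17))) (done 12))) (done 6))))
  (split 11 2 (done 23) (done 16))) (split 11 2 (split 9 1 (done 8) (done 3)) (done 2)))) (split 9 2
  (split 10 2 (split 8 1 (split 11 1 (done 13) (done 8)) (split 11 1 (done 6) (done 3))) (split 11 1
  (split 8 0 (split 0 1 (split 5 0 (split 4 2 (split 3 2 (clash 9 4 3 2) (split 10 1 (clash 11 0 10 1)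
  (done 21))) (split 6 2 (split 1 2 (clash 9 6 1 2) (split 10 1 (clash 11 0 10 1) (done 21))) (split 10 0
  (clash 8 5 10 0) (done 6)))) (split 7 0 (split 4 2 (split 3 2 (clash 9 4 3 2) (split 10 1 (clash 11 0 10 1)
  (done 21))) (split 6 2 (split 1 2 (clash 9 6 1 2) (split 10 1 (clash 11 0 10 1) (done 21))) (split 10 0
  (clash 8 7 10 0) (done 6)))) (done 17))) (split 2 1 (split 5 0 (split 4 2 (split 3 2 (clash 9 4 3 2)
  (split 10 1 (clash 11 2 10 1) (done 21))) (split 6 2 (split 1 2 (clash 9 6 1 2) (split 10 1
  (clash 11 2 10 1) (done 21))) (split 10 0 (clash 8 5 10 0) (done 6)))) (split 7 0 (split 4 2 (split 3 2
  (clash 9 4 3 2) (split 10 1 (clash 11 2 10 1) (done 21))) (split 6 2 (split 1 2 (clash 9 6 1 2) (split 10 1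
  (clash 11 2 10 1) (done 21))) (split 10 0 (clash 8 7 10 0) (done 6)))) (done 17))) (done 11))) (done 16))
  (done 1))) (split 10 2 (split 11 0 (split 8 1 (split 1 1 (split 4 0 (split 5 2 (split 2 2 (clash 10 5 2 2)
  (split 9 1 (clash 8 1 9 1) (done 22))) (split 7 2 (split 0 2 (clash 10 7 0 2) (split 9 1 (clash 8 1 9 1)
  (done 22))) (split 9 0 (clash 11 4 9 0) (done 8)))) (split 6 0 (split 5 2 (split 2 2 (clash 10 5 2 2)
  (split 9 1 (clash 8 1 9 1) (done 22))) (split 7 2 (split 0 2 (clash 10 7 0 2) (split 9 1 (clash 8 1 9 1)
  (done 22))) (split 9 0 (clash 11 6 9 0) (done 8)))) (done 15))) (split 3 1 (split 4 0 (split 5 2 (split 2 2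
  (clash 10 5 2 2) (split 9 1 (clash 8 3 9 1) (done 22))) (split 7 2 (split 0 2 (clash 10 7 0 2) (split 9 1
  (clash 8 3 9 1) (done 22))) (split 9 0 (clash 11 4 9 0) (done 8)))) (split 6 0 (split 5 2 (split 2 2
  (clash 10 5 2 2) (split 9 1 (clash 8 3 9 1) (done 22))) (split 7 2 (split 0 2 (clash 10 7 0 2) (split 9 1
  (clash 8 3 9 1) (done 22))) (split 9 0 (clash 11 6 9 0) (done 8)))) (done 15))) (done 12))) (done 2))
  (done 7)) (split 11 2 (split 9 1 (split 10 0 (split 1 1 (split 5 0 (split 4 2 (split 2 2 (clash 11 4 2 2)
  (split 8 1 (clash 9 1 8 1) (done 21))) (split 6 2 (split 0 2 (clash 11 6 0 2) (split 8 1 (clash 9 1 8 1)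
  (done 21))) (split 8 0 (clash 10 5 8 0) (done 8)))) (split 7 0 (split 4 2 (split 2 2 (clash 11 4 2 2)
  (split 8 1 (clash 9 1 8 1) (done 21))) (split 6 2 (split 0 2 (clash 11 6 0 2) (split 8 1 (clash 9 1 8 1)
  (done 21))) (split 8 0 (clash 10 7 8 0) (done 8)))) (done 15))) (split 3 1 (split 5 0 (split 4 2 (split 2 2
  (clash 11 4 2 2) (split 8 1 (clash 9 3 8 1) (done 21))) (split 6 2 (split 0 2 (clash 11 6 0 2) (split 8 1
  (clash 9 3 8 1) (done 21))) (split 8 0 (clash 10 5 8 0) (done 8)))) (split 7 0 (split 4 2 (split 2 2
  (clash 11 4 2 2) (split 8 1 (clash 9 3 8 1) (done 21))) (split 6 2 (split 0 2 (clash 11 6 0 2) (split 8 1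
  (clash 9 3 8 1) (done 21))) (split 8 0 (clash 10 7 8 0) (done 8)))) (done 15))) (done 11))) (done 7))
  (done 1)) (done 0)))))))))))))

colouring-avoidable : ∀ φ n → (∀ a → φ (edge a) ≢ just (colouring n a)) → Avoidable φ
colouring-avoidable φ n avoids = colouring n ∘ index , proper , avoids′
  where
  index : Edge 3 → Fin 12
  index = proj₁ ∘ edge-surjective
  edge∘index : ∀ e → edge (index e) ≡ e
  edge∘index = proj₂ ∘ edge-surjective
  proper : IsProperColoring (colouring n ∘ index)
  proper e e′ adj = colouring-proper n (index e) (index e′)
    (subst₂ AdjEdges (sym (edge∘index e)) (sym (edge∘index e′)) adj)
  avoids′ : ∀ e c → φ e ≡ just c → colouring n (index e) ≢ c
  avoids′ e c φe≡c refl = avoids (index e) (trans (cong φ (edge∘index e)) φe≡c)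

allAvoidable-3 : AllAvoidable 3
allAvoidable-3 φ proper tame =
  -- the underscore, of type T (valid [] [] certificate), is solved by running the check
  uncurry (colouring-avoidable φ) (valid⇒avoiding φ proper tame [] [] certificate _ [] [])

corollary4p9 : (k : ℕ) → 1 ≤ k → (φ : PartialColoring (3 * k)) →
    IsProperPartial φ → AtMostOneSameColorAtDist1 φ → Avoidable φ
corollary4p9 k _ = Blowup.allAvoidable-* 3 k allAvoidable-3
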